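{- Let $X=(V,E)$ be a regular connected graph with a nonempty set $S$ of marked vertices. Fix a spanning tree $T$ and a marked vertex $a\in S$. Then the $1$-eigenspace of the transition matrix $U$ has the $\{0,\pm1\}$-basis $$\{z_e:e\in E\setminus E(T)\}\cup\{z_b:b\in S\setminus\{a\}\},$$ where the vectors $z_e,z_b\in\mathbb{R}^{\text{arcs}(X)}$ are defined as follows. (i) For each $e\in E\setminus E(T)$, choose a consistent orientation (direction of traversal) of the fundamental cycle containing $e$ relative to $T$; $z_e$ assigns $1$ to each arc of the cycle that follows this direction, $-1$ to its opposite arc, and $0$ to all other arcs. (ii) For each $b\in S\setminus\{a\}$, choose a path from $a$ to $b$ traversed from $a$ to $b$; $z_b$ assigns $1$ to each arc along the path following this direction, $-1$ to its opposite arc, and $0$ to all other arcs.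
   Context: $X$ is $k$-regular. An arc is an ordered pair $(u,v)$ of adjacent vertices ($u$ the tail). $R$ is the arc-reversal permutation matrix; $D_t$ is the $V\times\text{arcs}$ tail incidence matrix with $(D_t)_{x,(u,v)}=1$ iff $x=u$; $O_S$ is the identity matrix with its $[S,S]$ block zeroed. The transition matrix is $U=R\left(\frac{2}{k}D_t^TO_SD_t-I\right)$ (Grover coin at unmarked vertices, $-I$ coin at marked vertices).
   Formalization: The arc vectors, the 1-eigenspace of $U$ and the coefficients of linear combinations in the basis claim are taken over the rationals instead of the reals. -}

module Defs where

open import Data.Bool using (Bool; true; false; _∧_; _∨_; not; if_then_else_)
open import Data.Nat as ℕ using (ℕ; zero; suc; _<ᵇ_)
open import Data.Fin using (Fin; toℕ) renaming (_≟_ to _≟ᶠ_)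
open import Data.Integer using (+_)
open import Data.Rational as ℚ using (ℚ; 0ℚ; 1ℚ; _+_; _*_; _-_; -_; _/_)
open import Data.List using (List; []; _∷_; _++_; map; length; filterᵇ; allFin; cartesianProduct)
open import Data.List.Relation.Unary.All using (All)
open import Data.List.Relation.Unary.Unique.Propositional using (Unique)
open import Data.Product using (_×_; _,_; Σ; ∃)
open import Relation.Binary.PropositionalEquality using (_≡_)
open import Relation.Nullary using (¬_)
open import Relation.Nullary.Decidable using (⌊_⌋)

Graph : ℕ → Set
Graph n = Fin n → Fin n → Bool

IsSimple : ∀ {n} → Graph n → Set
IsSimple {n} G = (∀ u v → G u v ≡ G v u) × (∀ u → G u u ≡ false)

count : ∀ {n} → (Fin n → Bool) → ℕ
count {zero}  p = 0
count {suc n} p = (if p Data.Fin.zero then 1 else 0) ℕ.+ count (λ i → p (Data.Fin.suc i))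

degree : ∀ {n} → Graph n → Fin n → ℕ
degree G x = count (G x)

IsRegular : ∀ {n} → Graph n → ℕ → Set
IsRegular G k = ∀ x → degree G x ≡ k

data Walk {n} (G : Graph n) : Fin n → Fin n → List (Fin n) → Set where
  stop : ∀ u → Walk G u u (u ∷ [])
  step : ∀ {u w v xs} → G u w ≡ true → Walk G w v xs → Walk G u v (u ∷ xs)

IsPath : ∀ {n} → Graph n → Fin n → Fin n → List (Fin n) → Set
IsPath G u v xs = Walk G u v xs × Unique xs

IsConnected : ∀ {n} → Graph n → Set
IsConnected G = ∀ u v → ∃ λ xs → Walk G u v xs

HasCycle : ∀ {n} → Graph n → Set
HasCycle G = Σ _ λ x → Σ _ λ y → Σ _ λ xs →
  IsPath G x y xs × (3 ℕ.≤ length xs) × (G y x ≡ true)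

IsSpanningTree : ∀ {n} → Graph n → Graph n → Set
IsSpanningTree G T =
  (∀ u v → T u v ≡ T v u) × (∀ u v → T u v ≡ true → G u v ≡ true) ×
  IsConnected T × ¬ HasCycle T

-- Vectors and matrices indexed by ordered pairs of vertices.
-- ℚ^{arcs(X)} is embedded as the functions Fin n → Fin n → ℚ vanishing
-- off the arcs; arc-indexed matrices are padded with zeros.

ArcVec : ℕ → Set
ArcVec n = Fin n → Fin n → ℚ

Σᶠ : ∀ {n} → (Fin n → ℚ) → ℚ
Σᶠ {zero}  f = 0ℚ
Σᶠ {suc n} f = f Data.Fin.zero + Σᶠ (λ i → f (Data.Fin.suc i))

eqᵇ : ∀ {n} → Fin n → Fin n → Bool
eqᵇ x y = ⌊ x ≟ᶠ y ⌋

δ : Bool → ℚ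
δ b = if b then 1ℚ else 0ℚ

-- 2/k (the value at k = 0 is irrelevant: then there are no arcs)
twoOver : ℕ → ℚ
twoOver zero    = 0ℚ
twoOver (suc k) = (+ 2) / suc k

module Walk-matrices {n : ℕ} (G : Graph n) (k : ℕ) (S : Fin n → Bool) where

  R : Fin n → Fin n → Fin n → Fin n → ℚ
  R u v x y = δ (G u v ∧ eqᵇ x v ∧ eqᵇ y u)

  Dt : Fin n → Fin n → Fin n → ℚ
  Dt x u v = δ (G u v ∧ eqᵇ x u)

  OS : Fin n → Fin n → ℚ
  OS x y = δ (eqᵇ x y ∧ not (S x))

  Iarc : Fin n → Fin n → Fin n → Fin n → ℚ
  Iarc u v x y = δ (G u v ∧ eqᵇ u x ∧ eqᵇ v y)

  DOD : Fin n → Fin n → Fin n → Fin n → ℚ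
  DOD u v x y = Σᶠ λ p → Σᶠ λ q → Dt p u v * OS p q * Dt q x y

  M : Fin n → Fin n → Fin n → Fin n → ℚ
  M u v x y = twoOver k * DOD u v x y - Iarc u v x y

  U : Fin n → Fin n → Fin n → Fin n → ℚ
  U u v x y = Σᶠ λ p → Σᶠ λ q → R u v p q * M p q x y

  applyU : ArcVec n → ArcVec n
  applyU f u v = Σᶠ λ x → Σᶠ λ y → U u v x y * f x y

  InEigen1 : ArcVec n → Set
  InEigen1 f = (∀ u v → G u v ≡ false → f u v ≡ 0ℚ) × (∀ u v → applyU f u v ≡ f u v)

lincomb : ∀ {n} (zs : List (ArcVec n)) → (Fin (length zs) → ℚ) → ArcVec n
lincomb []       c u v = 0ℚ
lincomb (z ∷ zs) c u v = c Data.Fin.zero * z u v + lincomb zs (λ i → c (Data.Fin.suc i)) u v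

LinIndep : ∀ {n} → List (ArcVec n) → Set
LinIndep zs = ∀ c → (∀ u v → lincomb zs c u v ≡ 0ℚ) → ∀ i → c i ≡ 0ℚ

IsBasisOf : ∀ {n} → (ArcVec n → Set) → List (ArcVec n) → Set
IsBasisOf W zs = All W zs × LinIndep zs ×
  (∀ f → W f → ∃ λ c → ∀ u v → lincomb zs c u v ≡ f u v)

stepIn : ∀ {n} → List (Fin n) → Fin n → Fin n → Bool
stepIn (x ∷ y ∷ xs) u v = (eqᵇ x u ∧ eqᵇ y v) ∨ stepIn (y ∷ xs) u v
stepIn _            u v = false

walkVec : ∀ {n} → List (Fin n) → ArcVec n
walkVec w u v = if stepIn w u v then 1ℚ else (if stepIn w v u then - 1ℚ else 0ℚ)

nonTreeEdges : ∀ {n} → Graph n → Graph n → List (Fin n × Fin n)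
nonTreeEdges {n} G T = filterᵇ (λ { (u , v) → (toℕ u <ᵇ toℕ v) ∧ G u v ∧ not (T u v) })
  (cartesianProduct (allFin n) (allFin n))

otherMarked : ∀ {n} → (Fin n → Bool) → Fin n → List (Fin n)
otherMarked {n} S a = filterᵇ (λ b → S b ∧ not (eqᵇ b a)) (allFin n)

oriented : ∀ {n} → Bool → Fin n × Fin n → Fin n × Fin n
oriented true  (u , v) = (u , v)
oriented false (u , v) = (v , u)

tailOf headOf : ∀ {n} → Fin n × Fin n → Fin n
tailOf (x , _) = x
headOf (_ , y) = y

module Submission where

-- On an arc (u , v) one computes U f (u , v) = (2/k) [v ∉ S] outflow(f, v) − f (v , u). So f is fixed by U
-- iff it vanishes off the arcs and f u v + f v u = (2/k) [v ∉ S] outflow(f, v) = (2/k) [u ∉ S] outflow(f, u);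
-- by connectivity this quantity is the same at every vertex, and it vanishes at the marked vertex a. Thus the
-- 1-eigenspace consists of the antisymmetric arc functions whose outflow vanishes off S. The vectors z_e and
-- z_b are such flows, being walk vectors of closed walks and of paths from a into S. The coordinates
-- κ_b(f) = −outflow(f, b) and κ_e(f) = (f − Σ κ_b(f) z_b)(arc of e) are dual to them, giving independence;
-- and f − Σ κ_b(f) z_b − Σ κ_e(f) z_e is a circulation supported on the spanning tree, hence zero, since
-- following its arcs of positive flow would never close a cycle.

open import Defs
open import Data.Bool using (Bool; true; false; _∧_; _∨_; not; if_then_else_; T)
open import Data.Nat as ℕ using (ℕ; zero; suc)
open import Data.Fin as F using (Fin; toℕ) renaming (_≟_ to _≟ᶠ_)
open import Data.Rational as ℚ using (ℚ; 0ℚ; 1ℚ; _+_; _*_; _-_; -_; 1/_)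
open import Data.Rational.Properties
  using ( +-*-commutativeRing; +-0-group; +-assoc; +-comm; +-identityˡ; +-identityʳ; +-inverseʳ; neg-distrib-+
        ; *-assoc; *-comm; *-identityˡ; *-identityʳ; *-zeroˡ; *-zeroʳ; *-inverseˡ; normalize-pos; 1≢0
        ; ≤-refl; ≤-reflexive; ≤-trans; +-mono-≤; +-monoˡ-≤; +-monoʳ-≤; ≮⇒≥
        ; _<?_; <-irrefl; <-asym; ≤-<-trans; <-cmp; neg-antimono-< )
open import Data.Rational.Solver using (module +-*-Solver)
open import Data.Bool.Properties using (∧-conicalˡ; ∧-conicalʳ; ¬-not; T-≡; T-not-≡; T-∧; T?)
open import Data.Fin.Properties using (suc-injective; any?; pigeonhole; toℕ-injective)
open import Function using (_∘_; case_of_; Equivalence)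
open import Data.Empty using (⊥; ⊥-elim)
open import Data.Product using (_×_; _,_; ∃; proj₁; proj₂)
open import Data.Sum using (_⊎_; inj₁; inj₂; [_,_]′)
open import Data.Vec.Functional using () renaming (_∷_ to _∷ᵛ_)
open import Relation.Binary.Definitions using (tri<; tri≈; tri>)
open import Data.List using (List; []; _∷_; _++_; map; length; lookup; filterᵇ; allFin; cartesianProduct)
open import Data.List.Membership.Propositional using (_∈_; _∉_)
open import Data.List.Membership.Propositional.Properties using (∈-lookup; ∈-filter⁻; ∈-filter⁺; ∈-cartesianProduct⁺; ∈-allFin)
open import Data.List.Relation.Unary.Any using (here; there)
open import Data.List.Relation.Unary.All as All using (All; []; _∷_)
import Data.List.Relation.Unary.All.Properties as All
open import Data.List.Relation.Unary.AllPairs using ([]; _∷_)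
open import Data.List.Relation.Unary.Unique.Propositional using (Unique)
open import Data.List.Relation.Unary.Unique.Propositional.Properties using (Unique[x∷xs]⇒x∉xs; filter⁺; cartesianProduct⁺; allFin⁺)
import Data.Nat.Properties as ℕₚ
open import Relation.Binary.PropositionalEquality
open import Relation.Nullary using (¬_; yes; no)
open import Algebra.Bundles using (CommutativeRing)
open import Algebra.Properties.Group +-0-group using (inverseˡ-unique)
open import Algebra.Properties.Semiring.Sum (CommutativeRing.semiring +-*-commutativeRing) using (sum; ∑-distrib-+; ∑-comm; *-distribˡ-sum; *-distribʳ-sum; sum-cong-≗)

open ≡-Reasoning
open +-*-Solver using (solve; _:=_; _:+_; _:*_; :-_; _:-_; con)

*-cancelˡ-≢0 : ∀ c {x y} → ¬ c ≡ 0ℚ → c * x ≡ c * y → x ≡ y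
*-cancelˡ-≢0 c {x} {y} c≢0 cx≡cy = begin
  x                ≡⟨ *-identityˡ x ⟨
  1ℚ * x           ≡⟨ cong (_* x) (*-inverseˡ c) ⟨
  1/ c * c * x     ≡⟨ *-assoc (1/ c) c x ⟩
  1/ c * (c * x)   ≡⟨ cong (1/ c *_) cx≡cy ⟩
  1/ c * (c * y)   ≡⟨ *-assoc (1/ c) c y ⟨
  1/ c * c * y     ≡⟨ cong (_* y) (*-inverseˡ c) ⟩
  1ℚ * y           ≡⟨ *-identityˡ y ⟩
  y                ∎
  where instance _ = ℚ.≢-nonZero c≢0

x≡-x⇒x≡0 : ∀ {x} → x ≡ - x → x ≡ 0ℚ
x≡-x⇒x≡0 {x} x≡-x = *-cancelˡ-≢0 (1ℚ + 1ℚ) (λ ()) (begin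
  (1ℚ + 1ℚ) * x   ≡⟨ solve 1 (λ x → (con 1ℚ :+ con 1ℚ) :* x := x :+ x) refl x ⟩
  x + x           ≡⟨ cong (x +_) x≡-x ⟩
  x + - x         ≡⟨ +-inverseʳ x ⟩
  0ℚ              ≡⟨ *-zeroʳ (1ℚ + 1ℚ) ⟨
  (1ℚ + 1ℚ) * 0ℚ  ∎)

Σᶠ≡sum : ∀ {n} (f : Fin n → ℚ) → Σᶠ f ≡ sum f
Σᶠ≡sum {zero}  f = refl
Σᶠ≡sum {suc n} f = cong (f F.zero +_) (Σᶠ≡sum (λ i → f (F.suc i)))

Σᶠ-cong : ∀ {n} {f g : Fin n → ℚ} → (∀ i → f i ≡ g i) → Σᶠ f ≡ Σᶠ g
Σᶠ-cong {zero}  f≗g = refl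
Σᶠ-cong {suc n} f≗g = cong₂ _+_ (f≗g F.zero) (Σᶠ-cong (λ i → f≗g (F.suc i)))

Σᶠ-zero : ∀ {n} {f : Fin n → ℚ} → (∀ i → f i ≡ 0ℚ) → Σᶠ f ≡ 0ℚ
Σᶠ-zero {zero}  f≗0 = refl
Σᶠ-zero {suc n} f≗0 = cong₂ _+_ (f≗0 F.zero) (Σᶠ-zero (λ i → f≗0 (F.suc i)))

Σᶠ-distrib-+ : ∀ {n} (f g : Fin n → ℚ) → Σᶠ (λ i → f i + g i) ≡ Σᶠ f + Σᶠ g
Σᶠ-distrib-+ f g = begin
  Σᶠ (λ i → f i + g i) ≡⟨ Σᶠ≡sum (λ i → f i + g i) ⟩
  sum (λ i → f i + g i) ≡⟨ ∑-distrib-+ f g ⟩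
  sum f + sum g         ≡⟨ cong₂ _+_ (Σᶠ≡sum f) (Σᶠ≡sum g) ⟨
  Σᶠ f + Σᶠ g           ∎

*-distribˡ-Σᶠ : ∀ {n} α (f : Fin n → ℚ) → α * Σᶠ f ≡ Σᶠ (λ i → α * f i)
*-distribˡ-Σᶠ α f = begin
  α * Σᶠ f              ≡⟨ cong (α *_) (Σᶠ≡sum f) ⟩
  α * sum f             ≡⟨ *-distribˡ-sum α f ⟩
  sum (λ i → α * f i)   ≡⟨ Σᶠ≡sum (λ i → α * f i) ⟨
  Σᶠ (λ i → α * f i)    ∎

*-distribʳ-Σᶠ : ∀ {n} α (f : Fin n → ℚ) → Σᶠ f * α ≡ Σᶠ (λ i → f i * α)
*-distribʳ-Σᶠ α f = begin
  Σᶠ f * α              ≡⟨ cong (_* α) (Σᶠ≡sum f) ⟩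
  sum f * α             ≡⟨ *-distribʳ-sum α f ⟩
  sum (λ i → f i * α)   ≡⟨ Σᶠ≡sum (λ i → f i * α) ⟨
  Σᶠ (λ i → f i * α)    ∎

Σᶠ-neg : ∀ {n} (f : Fin n → ℚ) → Σᶠ (λ i → - f i) ≡ - Σᶠ f
Σᶠ-neg {zero}  f = refl
Σᶠ-neg {suc n} f = trans (cong (- f F.zero +_) (Σᶠ-neg (λ i → f (F.suc i))))
                         (sym (neg-distrib-+ (f F.zero) _))

Σᶠ-distrib-- : ∀ {n} (f g : Fin n → ℚ) → Σᶠ (λ i → f i - g i) ≡ Σᶠ f - Σᶠ g
Σᶠ-distrib-- f g = trans (Σᶠ-distrib-+ f (λ i → - g i)) (cong (Σᶠ f +_) (Σᶠ-neg g))

Σᶠ-comm : ∀ {m n} (f : Fin m → Fin n → ℚ) → Σᶠ (λ i → Σᶠ (f i)) ≡ Σᶠ (λ j → Σᶠ (λ i → f i j))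
Σᶠ-comm f = begin
  Σᶠ (λ i → Σᶠ (f i))             ≡⟨ Σᶠ≡sum (λ i → Σᶠ (f i)) ⟩
  sum (λ i → Σᶠ (f i))            ≡⟨ sum-cong-≗ (λ i → Σᶠ≡sum (f i)) ⟩
  sum (λ i → sum (f i))           ≡⟨ ∑-comm f ⟩
  sum (λ j → sum (λ i → f i j))   ≡⟨ sum-cong-≗ (λ j → Σᶠ≡sum (λ i → f i j)) ⟨
  sum (λ j → Σᶠ (λ i → f i j))    ≡⟨ Σᶠ≡sum (λ j → Σᶠ (λ i → f i j)) ⟨
  Σᶠ (λ j → Σᶠ (λ i → f i j))     ∎

Σᶠ-concentrated : ∀ {n} (f : Fin n → ℚ) a → (∀ i → ¬ i ≡ a → f i ≡ 0ℚ) → Σᶠ f ≡ f a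
Σᶠ-concentrated {suc n} f F.zero     f≗0 =
  trans (cong (f F.zero +_) (Σᶠ-zero (λ i → f≗0 (F.suc i) λ ()))) (+-identityʳ _)
Σᶠ-concentrated {suc n} f (F.suc a) f≗0 =
  trans (cong₂ _+_ (f≗0 F.zero λ ())
                   (Σᶠ-concentrated (λ i → f (F.suc i)) a (λ i i≢a → f≗0 (F.suc i) (i≢a ∘ suc-injective))))
        (+-identityˡ _)

Σᶠ-linear : ∀ {n} α (f g : Fin n → ℚ) → Σᶠ (λ i → α * f i - g i) ≡ α * Σᶠ f - Σᶠ g
Σᶠ-linear α f g = begin
  Σᶠ (λ i → α * f i - g i)      ≡⟨ Σᶠ-distrib-- (λ i → α * f i) g ⟩
  Σᶠ (λ i → α * f i) - Σᶠ g     ≡⟨ cong (_- Σᶠ g) (*-distribˡ-Σᶠ α f) ⟨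
  α * Σᶠ f - Σᶠ g               ∎

Σᶠ-nonpos : ∀ {n} (f : Fin n → ℚ) → (∀ i → f i ℚ.≤ 0ℚ) → Σᶠ f ℚ.≤ 0ℚ
Σᶠ-nonpos {zero}  f f≤0 = ≤-refl
Σᶠ-nonpos {suc n} f f≤0 = +-mono-≤ (f≤0 F.zero) (Σᶠ-nonpos (f ∘ F.suc) (f≤0 ∘ F.suc))

Σᶠ-≤-term : ∀ {n} (f : Fin n → ℚ) → (∀ i → f i ℚ.≤ 0ℚ) → ∀ j → Σᶠ f ℚ.≤ f j
Σᶠ-≤-term f f≤0 F.zero =
  ≤-trans (+-monoʳ-≤ (f F.zero) (Σᶠ-nonpos (f ∘ F.suc) (f≤0 ∘ F.suc))) (≤-reflexive (+-identityʳ (f F.zero)))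
Σᶠ-≤-term f f≤0 (F.suc j) =
  ≤-trans (+-monoˡ-≤ (Σᶠ (f ∘ F.suc)) (f≤0 F.zero))
          (≤-trans (≤-reflexive (+-identityˡ _)) (Σᶠ-≤-term (f ∘ F.suc) (f≤0 ∘ F.suc) j))

∃-positive-term : ∀ {n} (f : Fin n → ℚ) j → Σᶠ f ≡ 0ℚ → f j ℚ.< 0ℚ → ∃ λ i → 0ℚ ℚ.< f i
∃-positive-term f j Σf≡0 fj<0 with any? (λ i → 0ℚ <? f i)
... | yes positive = positive
... | no ∄positive = ⊥-elim (<-irrefl refl (≤-<-trans 0≤fj fj<0))
  where
  0≤fj : 0ℚ ℚ.≤ f j
  0≤fj = subst (ℚ._≤ f j) Σf≡0 (Σᶠ-≤-term f (λ i → ≮⇒≥ (λ 0<fi → ∄positive (i , 0<fi))) j)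

eqᵇ-refl : ∀ {n} (x : Fin n) → eqᵇ x x ≡ true
eqᵇ-refl x with x ≟ᶠ x
... | yes _   = refl
... | no x≢x = ⊥-elim (x≢x refl)

eqᵇ-≢ : ∀ {n} {x y : Fin n} → ¬ x ≡ y → eqᵇ x y ≡ false
eqᵇ-≢ {x = x} {y} x≢y with x ≟ᶠ y
... | yes x≡y = ⊥-elim (x≢y x≡y)
... | no _    = refl

eqᵇ⇒≡ : ∀ {n} {x y : Fin n} → eqᵇ x y ≡ true → x ≡ y
eqᵇ⇒≡ {x = x} {y} eq with x ≟ᶠ y
... | yes x≡y = x≡y

eqᵇ-pair⇒≡ : ∀ {n} (x y u v : Fin n) → eqᵇ x u ∧ eqᵇ y v ≡ true → x ≡ u × y ≡ v
eqᵇ-pair⇒≡ x y u v eq = eqᵇ⇒≡ (∧-conicalˡ (eqᵇ x u) (eqᵇ y v) eq) , eqᵇ⇒≡ (∧-conicalʳ (eqᵇ x u) (eqᵇ y v) eq)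

δ-∧ : ∀ a b → δ (a ∧ b) ≡ δ a * δ b
δ-∧ true  b = sym (*-identityˡ (δ b))
δ-∧ false b = sym (*-zeroˡ (δ b))

Σᶠ-δ : ∀ {n} (P : Fin n → Bool) a (g : Fin n → ℚ) →
       P a ≡ true → (∀ x → P x ≡ true → x ≡ a) → Σᶠ (λ x → δ (P x) * g x) ≡ g a
Σᶠ-δ P a g Pa P⇒a = begin
  Σᶠ (λ x → δ (P x) * g x) ≡⟨ Σᶠ-concentrated _ a off-a ⟩
  δ (P a) * g a            ≡⟨ cong (λ b → δ b * g a) Pa ⟩
  1ℚ * g a                 ≡⟨ *-identityˡ (g a) ⟩
  g a                      ∎
  where
  off-a : ∀ x → ¬ x ≡ a → δ (P x) * g x ≡ 0ℚ
  off-a x x≢a with P x in Px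
  ... | true  = ⊥-elim (x≢a (P⇒a x Px))
  ... | false = *-zeroˡ (g x)

Σᶠ-δˡ : ∀ {n} (a : Fin n) (g : Fin n → ℚ) → Σᶠ (λ x → δ (eqᵇ x a) * g x) ≡ g a
Σᶠ-δˡ a g = Σᶠ-δ (λ x → eqᵇ x a) a g (eqᵇ-refl a) (λ x → eqᵇ⇒≡)

Σᶠ-δʳ : ∀ {n} (a : Fin n) (g : Fin n → ℚ) → Σᶠ (λ x → δ (eqᵇ a x) * g x) ≡ g a
Σᶠ-δʳ a g = Σᶠ-δ (λ x → eqᵇ a x) a g (eqᵇ-refl a) (λ x → sym ∘ eqᵇ⇒≡)

δ-pair-≡0 : ∀ {n} {x y u v : Fin n} → ¬ (x ≡ u × y ≡ v) → δ (eqᵇ x u ∧ eqᵇ y v) ≡ 0ℚ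
δ-pair-≡0 {x = x} {y} {u} {v} x,y≢u,v with eqᵇ x u in x≡u | eqᵇ y v in y≡v
... | true  | true  = ⊥-elim (x,y≢u,v (eqᵇ⇒≡ x≡u , eqᵇ⇒≡ y≡v))
... | true  | false = refl
... | false | _     = refl

SupportedOn : ∀ {n} → Graph n → ArcVec n → Set
SupportedOn G f = ∀ u v → G u v ≡ false → f u v ≡ 0ℚ

Antisymmetric : ∀ {n} → ArcVec n → Set
Antisymmetric f = ∀ u v → f u v ≡ - f v u

outflow : ∀ {n} → ArcVec n → Fin n → ℚ
outflow f u = Σᶠ (f u)

record IsFlow {n} (G : Graph n) (S : Fin n → Bool) (f : ArcVec n) : Set where
  field
    supported     : SupportedOn G f
    antisymmetric : Antisymmetric f
    conserved     : ∀ u → S u ≡ false → outflow f u ≡ 0ℚ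

outflowᴳ : ∀ {n} → Graph n → ArcVec n → Fin n → ℚ
outflowᴳ G f u = Σᶠ λ y → δ (G u y) * f u y

outflowᴳ-supported : ∀ {n} (G : Graph n) {f} → SupportedOn G f → ∀ u → outflowᴳ G f u ≡ outflow f u
outflowᴳ-supported G {f} supp u = Σᶠ-cong on-arcs
  where
  on-arcs : ∀ y → δ (G u y) * f u y ≡ f u y
  on-arcs y with G u y in Guy
  ... | true  = *-identityˡ (f u y)
  ... | false = trans (*-zeroˡ (f u y)) (sym (supp u y Guy))

-- The outflows of an antisymmetric arc function sum to zero.
conserved-at-remaining-vertex : ∀ {n} {g : ArcVec n} → Antisymmetric g →
                                ∀ a → (∀ w → ¬ w ≡ a → outflow g w ≡ 0ℚ) → ∀ w → outflow g w ≡ 0ℚ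
conserved-at-remaining-vertex {g = g} antisym a conserved w with w ≟ᶠ a
... | no  w≢a  = conserved w w≢a
... | yes refl = trans (sym (Σᶠ-concentrated (outflow g) w conserved)) total≡0
  where
  total≡0 : Σᶠ (outflow g) ≡ 0ℚ
  total≡0 = x≡-x⇒x≡0 (begin
    (Σᶠ λ u → Σᶠ λ v → g u v)      ≡⟨ Σᶠ-cong (λ u → Σᶠ-cong (antisym u)) ⟩
    (Σᶠ λ u → Σᶠ λ v → - g v u)    ≡⟨ Σᶠ-cong (λ u → Σᶠ-neg (λ v → g v u)) ⟩
    (Σᶠ λ u → - Σᶠ λ v → g v u)    ≡⟨ Σᶠ-neg (λ u → Σᶠ λ v → g v u) ⟩
    - (Σᶠ λ u → Σᶠ λ v → g v u)    ≡⟨ cong -_ (Σᶠ-comm (λ u v → g v u)) ⟩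
    - (Σᶠ λ v → Σᶠ λ u → g v u)    ∎)

-- The transition matrix

⟪_∣_⟫ : ∀ {n} → (Fin n → Fin n → ℚ) → ArcVec n → ℚ
⟪ K ∣ f ⟫ = Σᶠ λ x → Σᶠ λ y → K x y * f x y

⟪⟫-assoc : ∀ {n} (A : Fin n → Fin n → ℚ) (B : Fin n → Fin n → Fin n → Fin n → ℚ) (f : ArcVec n) →
           ⟪ (λ x y → Σᶠ λ p → Σᶠ λ q → A p q * B p q x y) ∣ f ⟫ ≡ ⟪ A ∣ (λ p q → ⟪ B p q ∣ f ⟫) ⟫
⟪⟫-assoc A B f = begin
  (Σᶠ λ x → Σᶠ λ y → (Σᶠ λ p → Σᶠ λ q → A p q * B p q x y) * f x y)
    ≡⟨ Σᶠ-cong (λ x → Σᶠ-cong (λ y → distrib x y)) ⟩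
  (Σᶠ λ x → Σᶠ λ y → Σᶠ λ p → Σᶠ λ q → A p q * (B p q x y * f x y))
    ≡⟨ Σᶠ-cong (λ x → Σᶠ-comm (λ y p → Σᶠ λ q → E x y p q)) ⟩
  (Σᶠ λ x → Σᶠ λ p → Σᶠ λ y → Σᶠ λ q → E x y p q)
    ≡⟨ Σᶠ-cong (λ x → Σᶠ-cong (λ p → Σᶠ-comm (λ y q → E x y p q))) ⟩
  (Σᶠ λ x → Σᶠ λ p → Σᶠ λ q → Σᶠ λ y → E x y p q)
    ≡⟨ Σᶠ-comm (λ x p → Σᶠ λ q → Σᶠ λ y → E x y p q) ⟩
  (Σᶠ λ p → Σᶠ λ x → Σᶠ λ q → Σᶠ λ y → E x y p q)
    ≡⟨ Σᶠ-cong (λ p → Σᶠ-comm (λ x q → Σᶠ λ y → E x y p q)) ⟩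
  (Σᶠ λ p → Σᶠ λ q → Σᶠ λ x → Σᶠ λ y → A p q * (B p q x y * f x y))
    ≡⟨ Σᶠ-cong (λ p → Σᶠ-cong (λ q → factor p q)) ⟩
  (Σᶠ λ p → Σᶠ λ q → A p q * ⟪ B p q ∣ f ⟫)
    ∎
  where
  E = λ x y p q → A p q * (B p q x y * f x y)
  distrib : ∀ x y → (Σᶠ λ p → Σᶠ λ q → A p q * B p q x y) * f x y ≡ Σᶠ λ p → Σᶠ λ q → E x y p q
  distrib x y = trans (*-distribʳ-Σᶠ (f x y) (λ p → Σᶠ λ q → A p q * B p q x y)) (Σᶠ-cong λ p →
                  trans (*-distribʳ-Σᶠ (f x y) (λ q → A p q * B p q x y))
                        (Σᶠ-cong λ q → *-assoc (A p q) (B p q x y) (f x y)))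
  factor : ∀ p q → (Σᶠ λ x → Σᶠ λ y → E x y p q) ≡ A p q * ⟪ B p q ∣ f ⟫
  factor p q = sym (trans (*-distribˡ-Σᶠ (A p q) (λ x → Σᶠ λ y → B p q x y * f x y))
                          (Σᶠ-cong λ x → *-distribˡ-Σᶠ (A p q) (λ y → B p q x y * f x y)))

⟪⟫-linear : ∀ {n} α (K L : Fin n → Fin n → ℚ) (f : ArcVec n) →
            ⟪ (λ x y → α * K x y - L x y) ∣ f ⟫ ≡ α * ⟪ K ∣ f ⟫ - ⟪ L ∣ f ⟫
⟪⟫-linear α K L f = begin
  (Σᶠ λ x → Σᶠ λ y → (α * K x y - L x y) * f x y)
    ≡⟨ Σᶠ-cong (λ x → Σᶠ-cong (λ y → distrib (K x y) (L x y) (f x y))) ⟩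
  (Σᶠ λ x → Σᶠ λ y → α * (K x y * f x y) - L x y * f x y)
    ≡⟨ Σᶠ-cong (λ x → Σᶠ-linear α (λ y → K x y * f x y) (λ y → L x y * f x y)) ⟩
  (Σᶠ λ x → α * (Σᶠ λ y → K x y * f x y) - (Σᶠ λ y → L x y * f x y))
    ≡⟨ Σᶠ-linear α (λ x → Σᶠ λ y → K x y * f x y) (λ x → Σᶠ λ y → L x y * f x y) ⟩
  α * ⟪ K ∣ f ⟫ - ⟪ L ∣ f ⟫
    ∎
  where
  distrib : ∀ k l x → (α * k - l) * x ≡ α * (k * x) - l * x
  distrib = solve 4 (λ α k l x → (α :* k :- l) :* x := α :* (k :* x) :- l :* x) refl α

⟪δ⟫ : ∀ {n} c (P Q : Fin n → Bool) a b (h : ArcVec n) →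
      P a ≡ true → (∀ x → P x ≡ true → x ≡ a) → Q b ≡ true → (∀ y → Q y ≡ true → y ≡ b) →
      ⟪ (λ x y → δ (c ∧ P x ∧ Q y)) ∣ h ⟫ ≡ δ c * h a b
⟪δ⟫ c P Q a b h Pa P⇒a Qb Q⇒b = begin
  (Σᶠ λ x → Σᶠ λ y → δ (c ∧ P x ∧ Q y) * h x y)
    ≡⟨ Σᶠ-cong (λ x → Σᶠ-cong (λ y → split x y)) ⟩
  (Σᶠ λ x → Σᶠ λ y → δ c * (δ (P x) * (δ (Q y) * h x y)))
    ≡⟨ Σᶠ-cong (λ x → trans (cong (δ c *_) (*-distribˡ-Σᶠ (δ (P x)) (λ y → δ (Q y) * h x y)))
                            (*-distribˡ-Σᶠ (δ c) (λ y → δ (P x) * (δ (Q y) * h x y)))) ⟨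
  (Σᶠ λ x → δ c * (δ (P x) * Σᶠ λ y → δ (Q y) * h x y))
    ≡⟨ *-distribˡ-Σᶠ (δ c) (λ x → δ (P x) * Σᶠ λ y → δ (Q y) * h x y) ⟨
  δ c * (Σᶠ λ x → δ (P x) * Σᶠ λ y → δ (Q y) * h x y)
    ≡⟨ cong (δ c *_) (trans (Σᶠ-δ P a (λ x → Σᶠ λ y → δ (Q y) * h x y) Pa P⇒a) (Σᶠ-δ Q b (h a) Qb Q⇒b)) ⟩
  δ c * h a b
    ∎
  where
  split : ∀ x y → δ (c ∧ P x ∧ Q y) * h x y ≡ δ c * (δ (P x) * (δ (Q y) * h x y))
  split x y = begin
    δ (c ∧ P x ∧ Q y) * h x y               ≡⟨ cong (_* h x y) (trans (δ-∧ c _) (cong (δ c *_) (δ-∧ (P x) (Q y)))) ⟩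
    δ c * (δ (P x) * δ (Q y)) * h x y       ≡⟨ solve 4 (λ c p q h → c :* (p :* q) :* h := c :* (p :* (q :* h))) refl
                                                 (δ c) (δ (P x)) (δ (Q y)) (h x y) ⟩
    δ c * (δ (P x) * (δ (Q y) * h x y))     ∎

module _ {n : ℕ} (G : Graph n) (k : ℕ) (S : Fin n → Bool) where
  open Walk-matrices G k S

  ⟪R⟫ : ∀ u v (h : ArcVec n) → ⟪ R u v ∣ h ⟫ ≡ δ (G u v) * h v u
  ⟪R⟫ u v h = ⟪δ⟫ (G u v) (λ x → eqᵇ x v) (λ y → eqᵇ y u) v u h
                (eqᵇ-refl v) (λ _ → eqᵇ⇒≡) (eqᵇ-refl u) (λ _ → eqᵇ⇒≡)

  ⟪Iarc⟫ : ∀ p q (f : ArcVec n) → ⟪ Iarc p q ∣ f ⟫ ≡ δ (G p q) * f p q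
  ⟪Iarc⟫ p q f = ⟪δ⟫ (G p q) (eqᵇ p) (eqᵇ q) p q f
                   (eqᵇ-refl p) (λ _ → sym ∘ eqᵇ⇒≡) (eqᵇ-refl q) (λ _ → sym ∘ eqᵇ⇒≡)

  ⟪Dt⟫ : ∀ b (f : ArcVec n) → ⟪ Dt b ∣ f ⟫ ≡ outflowᴳ G f b
  ⟪Dt⟫ b f = begin
    (Σᶠ λ x → Σᶠ λ y → δ (G x y ∧ eqᵇ b x) * f x y)
      ≡⟨ Σᶠ-cong (λ x → Σᶠ-cong (λ y → split x y)) ⟩
    (Σᶠ λ x → Σᶠ λ y → δ (eqᵇ b x) * (δ (G x y) * f x y))
      ≡⟨ Σᶠ-cong (λ x → *-distribˡ-Σᶠ (δ (eqᵇ b x)) (λ y → δ (G x y) * f x y)) ⟨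
    (Σᶠ λ x → δ (eqᵇ b x) * outflowᴳ G f x)
      ≡⟨ Σᶠ-δʳ b (outflowᴳ G f) ⟩
    outflowᴳ G f b
      ∎
    where
    split : ∀ x y → δ (G x y ∧ eqᵇ b x) * f x y ≡ δ (eqᵇ b x) * (δ (G x y) * f x y)
    split x y = begin
      δ (G x y ∧ eqᵇ b x) * f x y         ≡⟨ cong (_* f x y) (δ-∧ (G x y) (eqᵇ b x)) ⟩
      δ (G x y) * δ (eqᵇ b x) * f x y     ≡⟨ solve 3 (λ g e f → g :* e :* f := e :* (g :* f)) refl
                                              (δ (G x y)) (δ (eqᵇ b x)) (f x y) ⟩
      δ (eqᵇ b x) * (δ (G x y) * f x y)   ∎

  ⟪DOD⟫ : ∀ p q (f : ArcVec n) → ⟪ DOD p q ∣ f ⟫ ≡ δ (G p q) * (δ (not (S p)) * outflowᴳ G f p)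
  ⟪DOD⟫ p q f = begin
    ⟪ DOD p q ∣ f ⟫
      ≡⟨ ⟪⟫-assoc (λ a b → Dt a p q * OS a b) (λ _ b → Dt b) f ⟩
    (Σᶠ λ a → Σᶠ λ b → Dt a p q * OS a b * ⟪ Dt b ∣ f ⟫)
      ≡⟨ Σᶠ-cong (λ a → Σᶠ-cong (λ b → cong₂ _*_ (split a b) (⟪Dt⟫ b f))) ⟩
    (Σᶠ λ a → Σᶠ λ b → δ (G p q) * (δ (eqᵇ a p) * δ (not (S a))) * δ (eqᵇ a b) * outflowᴳ G f b)
      ≡⟨ Σᶠ-cong (λ a → Σᶠ-cong (λ b → *-assoc (δ (G p q) * (δ (eqᵇ a p) * δ (not (S a)))) (δ (eqᵇ a b)) (outflowᴳ G f b))) ⟩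
    (Σᶠ λ a → Σᶠ λ b → δ (G p q) * (δ (eqᵇ a p) * δ (not (S a))) * (δ (eqᵇ a b) * outflowᴳ G f b))
      ≡⟨ Σᶠ-cong (λ a → *-distribˡ-Σᶠ (δ (G p q) * (δ (eqᵇ a p) * δ (not (S a))))
                                        (λ b → δ (eqᵇ a b) * outflowᴳ G f b)) ⟨
    (Σᶠ λ a → δ (G p q) * (δ (eqᵇ a p) * δ (not (S a))) * (Σᶠ λ b → δ (eqᵇ a b) * outflowᴳ G f b))
      ≡⟨ Σᶠ-cong (λ a → cong (δ (G p q) * (δ (eqᵇ a p) * δ (not (S a))) *_) (Σᶠ-δʳ a (outflowᴳ G f))) ⟩
    (Σᶠ λ a → δ (G p q) * (δ (eqᵇ a p) * δ (not (S a))) * outflowᴳ G f a)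
      ≡⟨ Σᶠ-cong (λ a → regroup (δ (G p q)) (δ (eqᵇ a p)) (δ (not (S a))) (outflowᴳ G f a)) ⟩
    (Σᶠ λ a → δ (G p q) * (δ (eqᵇ a p) * (δ (not (S a)) * outflowᴳ G f a)))
      ≡⟨ *-distribˡ-Σᶠ (δ (G p q)) (λ a → δ (eqᵇ a p) * (δ (not (S a)) * outflowᴳ G f a)) ⟨
    δ (G p q) * (Σᶠ λ a → δ (eqᵇ a p) * (δ (not (S a)) * outflowᴳ G f a))
      ≡⟨ cong (δ (G p q) *_) (Σᶠ-δˡ p (λ a → δ (not (S a)) * outflowᴳ G f a)) ⟩
    δ (G p q) * (δ (not (S p)) * outflowᴳ G f p)
      ∎
    where
    split : ∀ a b → Dt a p q * OS a b ≡ δ (G p q) * (δ (eqᵇ a p) * δ (not (S a))) * δ (eqᵇ a b)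
    split a b = begin
      δ (G p q ∧ eqᵇ a p) * δ (eqᵇ a b ∧ not (S a))
        ≡⟨ cong₂ _*_ (δ-∧ (G p q) (eqᵇ a p)) (δ-∧ (eqᵇ a b) (not (S a))) ⟩
      δ (G p q) * δ (eqᵇ a p) * (δ (eqᵇ a b) * δ (not (S a)))
        ≡⟨ solve 4 (λ g e e′ s → g :* e :* (e′ :* s) := g :* (e :* s) :* e′) refl
             (δ (G p q)) (δ (eqᵇ a p)) (δ (eqᵇ a b)) (δ (not (S a))) ⟩
      δ (G p q) * (δ (eqᵇ a p) * δ (not (S a))) * δ (eqᵇ a b)
        ∎
    regroup : ∀ g e s o → g * (e * s) * o ≡ g * (e * (s * o))
    regroup = solve 4 (λ g e s o → g :* (e :* s) :* o := g :* (e :* (s :* o))) refl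

  applyU-≡ : ∀ (f : ArcVec n) u v →
             applyU f u v ≡ δ (G u v) * (twoOver k * (δ (G v u) * (δ (not (S v)) * outflowᴳ G f v)) - δ (G v u) * f v u)
  applyU-≡ f u v = begin
    applyU f u v                       ≡⟨ ⟪⟫-assoc (R u v) M f ⟩
    ⟪ R u v ∣ (λ p q → ⟪ M p q ∣ f ⟫) ⟫ ≡⟨ ⟪R⟫ u v (λ p q → ⟪ M p q ∣ f ⟫) ⟩
    δ (G u v) * ⟪ M v u ∣ f ⟫          ≡⟨ cong (δ (G u v) *_) (⟪⟫-linear (twoOver k) (DOD v u) (Iarc v u) f) ⟩
    δ (G u v) * (twoOver k * ⟪ DOD v u ∣ f ⟫ - ⟪ Iarc v u ∣ f ⟫)
      ≡⟨ cong (δ (G u v) *_) (cong₂ (λ d i → twoOver k * d - i) (⟪DOD⟫ v u f) (⟪Iarc⟫ v u f)) ⟩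
    δ (G u v) * (twoOver k * (δ (G v u) * (δ (not (S v)) * outflowᴳ G f v)) - δ (G v u) * f v u)
      ∎

-- The 1-eigenspace consists of the flows conserved off S

count-≢0 : ∀ {n} (p : Fin n → Bool) {v} → p v ≡ true → ¬ count p ≡ 0
count-≢0 p {F.zero}  pv eq with p F.zero | eq
... | true | ()
count-≢0 p {F.suc v} pv eq = count-≢0 (p ∘ F.suc) pv (ℕₚ.m+n≡0⇒n≡0 (if p F.zero then 1 else 0) eq)

twoOver-≢0 : ∀ {n} {G : Graph n} {k} → IsRegular G k → ∀ {u v} → G u v ≡ true → ¬ twoOver k ≡ 0ℚ
twoOver-≢0 {G = G} {k = zero}  regular {u} Guv _  = count-≢0 (G u) Guv (regular u)
twoOver-≢0         {k = suc k} regular     _   eq with () ← subst ℚ.Positive eq (normalize-pos 2 (suc k))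

module _ {n : ℕ} (G : Graph n) (k : ℕ) (S : Fin n → Bool) (simple : IsSimple G) where
  open Walk-matrices G k S

  applyU-arc : ∀ f u v → G u v ≡ true → applyU f u v ≡ twoOver k * (δ (not (S v)) * outflowᴳ G f v) - f v u
  applyU-arc f u v Guv = begin
    applyU f u v
      ≡⟨ applyU-≡ G k S f u v ⟩
    δ (G u v) * (twoOver k * (δ (G v u) * e) - δ (G v u) * f v u)
      ≡⟨ cong₂ (λ b c → δ b * (twoOver k * (δ c * e) - δ c * f v u)) Guv (trans (proj₁ simple v u) Guv) ⟩
    1ℚ * (twoOver k * (1ℚ * e) - 1ℚ * f v u)
      ≡⟨ solve 3 (λ t e x → con 1ℚ :* (t :* (con 1ℚ :* e) :- con 1ℚ :* x) := t :* e :- x) refl (twoOver k) e (f v u) ⟩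
    twoOver k * e - f v u
      ∎
    where e = δ (not (S v)) * outflowᴳ G f v

  applyU-nonarc : ∀ f u v → G u v ≡ false → applyU f u v ≡ 0ℚ
  applyU-nonarc f u v Guv = trans (applyU-≡ G k S f u v) (trans (cong (λ b → δ b * r) Guv) (*-zeroˡ r))
    where r = twoOver k * (δ (G v u) * (δ (not (S v)) * outflowᴳ G f v)) - δ (G v u) * f v u

  flow⇒inEigen1 : ∀ {f} → IsFlow G S f → InEigen1 f
  flow⇒inEigen1 {f} flow = supported , fixed
    where
    open IsFlow flow
    no-excess : ∀ v → δ (not (S v)) * outflowᴳ G f v ≡ 0ℚ
    no-excess v with S v in Sv
    ... | true  = *-zeroˡ (outflowᴳ G f v)
    ... | false = trans (cong (1ℚ *_) (trans (outflowᴳ-supported G supported v) (conserved v Sv))) (*-zeroʳ 1ℚ)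
    fixed : ∀ u v → applyU f u v ≡ f u v
    fixed u v = by-arc (G u v) refl
      where
      by-arc : ∀ b → G u v ≡ b → applyU f u v ≡ f u v
      by-arc false Guv = trans (applyU-nonarc f u v Guv) (sym (supported u v Guv))
      by-arc true  Guv = begin
        applyU f u v                                            ≡⟨ applyU-arc f u v Guv ⟩
        twoOver k * (δ (not (S v)) * outflowᴳ G f v) - f v u    ≡⟨ cong (λ x → twoOver k * x - f v u) (no-excess v) ⟩
        twoOver k * 0ℚ - f v u                                  ≡⟨ cong (_- f v u) (*-zeroʳ (twoOver k)) ⟩
        0ℚ - f v u                                              ≡⟨ +-identityˡ (- f v u) ⟩
        - f v u                                                 ≡⟨ antisymmetric u v ⟨
        f u v                                                   ∎

  inEigen1⇒flow : IsRegular G k → IsConnected G → ∀ {a} → S a ≡ true → ∀ {f} → InEigen1 f → IsFlow G S f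
  inEigen1⇒flow regular connected {a} Sa {f} (supp , fixed) =
    record { supported = supp ; antisymmetric = antisym ; conserved = conserved }
    where
    excess : Fin n → ℚ
    excess v = δ (not (S v)) * outflow f v

    arc-sum : ∀ {u v} → G u v ≡ true → f u v + f v u ≡ twoOver k * excess v
    arc-sum {u} {v} Guv = begin
      f u v + f v u
        ≡⟨ cong (_+ f v u) (trans (sym (fixed u v)) (applyU-arc f u v Guv)) ⟩
      twoOver k * (δ (not (S v)) * outflowᴳ G f v) - f v u + f v u
        ≡⟨ cong (λ x → twoOver k * (δ (not (S v)) * x) - f v u + f v u) (outflowᴳ-supported G supp v) ⟩
      twoOver k * excess v - f v u + f v u
        ≡⟨ solve 2 (λ x y → x :- y :+ y := x) refl (twoOver k * excess v) (f v u) ⟩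
      twoOver k * excess v
        ∎

    -- both orientations of an arc give the same sum f u v + f v u, and 2/k ≠ 0
    excess-step : ∀ {u v} → G u v ≡ true → excess u ≡ excess v
    excess-step {u} {v} Guv = *-cancelˡ-≢0 (twoOver k) (twoOver-≢0 regular Guv)
      (trans (sym (arc-sum (trans (proj₁ simple v u) Guv))) (trans (+-comm (f v u) (f u v)) (arc-sum Guv)))

    excess-walk : ∀ {u w xs} → Walk G u w xs → excess u ≡ excess w
    excess-walk (stop _)       = refl
    excess-walk (step Guv walk) = trans (excess-step Guv) (excess-walk walk)

    excess≡0 : ∀ v → excess v ≡ 0ℚ
    excess≡0 v = trans (excess-walk (proj₂ (connected v a))) (trans (cong (λ b → δ (not b) * outflow f a) Sa) (*-zeroˡ (outflow f a)))

    antisym : Antisymmetric f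
    antisym u v with G u v in Guv
    ... | true  = inverseˡ-unique (f u v) (f v u) (trans (arc-sum Guv) (trans (cong (twoOver k *_) (excess≡0 v)) (*-zeroʳ (twoOver k))))
    ... | false = trans (supp u v Guv) (sym (cong -_ (supp v u (trans (proj₁ simple v u) Guv))))

    conserved : ∀ u → S u ≡ false → outflow f u ≡ 0ℚ
    conserved u Su = trans (sym (*-identityˡ (outflow f u))) (trans (cong (λ b → δ (not b) * outflow f u) (sym Su)) (excess≡0 u))

-- Circulations on forests vanish

length-unique-≤ : ∀ {n} (l : List (Fin n)) → Unique l → length l ℕ.≤ n
length-unique-≤ {n} l unique with length l ℕ.≤? n
... | yes ≤n = ≤n
... | no  ≰n with i , j , i<j , lᵢ≡lⱼ ← pigeonhole (ℕₚ.≰⇒> ≰n) (lookup l) = ⊥-elim (lookup-distinct l unique i<j lᵢ≡lⱼ)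
  where
  lookup-distinct : ∀ {A : Set} (l : List A) → Unique l → ∀ {i j} → i F.< j → ¬ lookup l i ≡ lookup l j
  lookup-distinct (x ∷ l) (x∉l ∷ unique) {F.zero}  {F.suc j} _         x≡lⱼ =
    Unique[x∷xs]⇒x∉xs (x∉l ∷ unique) (subst (_∈ l) (sym x≡lⱼ) (∈-lookup j))
  lookup-distinct (x ∷ l) (_ ∷ unique)   {F.suc i} {F.suc j} (ℕ.s≤s i<j) = lookup-distinct l unique i<j

module _ {n} {G : Graph n} where

  walk-head : ∀ {a b x xs} → Walk G a b (x ∷ xs) → a ≡ x
  walk-head (stop _)   = refl
  walk-head (step _ _) = refl

  walk-length : ∀ {a b q} → Walk G a b q → ¬ a ≡ b → 2 ℕ.≤ length q
  walk-length (stop _)            a≢a = ⊥-elim (a≢a refl)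
  walk-length (step _ (stop _))   _   = ℕ.s≤s (ℕ.s≤s ℕ.z≤n)
  walk-length (step _ (step _ _)) _   = ℕ.s≤s (ℕ.s≤s ℕ.z≤n)

  edge-path : ∀ {x y} → G x y ≡ true → ¬ x ≡ y → IsPath G x y (x ∷ y ∷ [])
  edge-path {y = y} Gxy x≢y = step Gxy (stop y) , (x≢y ∷ []) ∷ [] ∷ []

  path-prefix : ∀ {w x ls z} → IsPath G w x ls → z ∈ ls →
                ∃ λ q → IsPath G w z q × (∀ {v} → v ∈ q → v ∈ ls)
  path-prefix (stop w , unique) (here refl) = _ , (stop w , [] ∷ []) , λ v∈q → v∈q
  path-prefix (step _ _ , _) (here refl) = _ , (stop _ , [] ∷ []) , λ { (here refl) → here refl }
  path-prefix {w = w} (step Gwy walk , w∉ls ∷ unique) (there z∈ls)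
    with q , (walk′ , unique′) , q⊆ls ← path-prefix (walk , unique) z∈ls =
    w ∷ q , (step Gwy walk′ , All.¬Any⇒All¬ q (λ w∈q → Unique[x∷xs]⇒x∉xs (w∉ls ∷ unique) (q⊆ls w∈q)) ∷ unique′) ,
    λ { (here refl) → here refl ; (there v∈q) → there (q⊆ls v∈q) }

module _ {n} {T : Graph n} (simple : IsSimple T) (acyclic : ¬ HasCycle T)
         {g : ArcVec n} (circulation : IsFlow T (λ _ → false) g) where
  open IsFlow circulation
  open import Data.List.Membership.DecPropositional (_≟ᶠ_ {n}) using (_∈?_)

  private
    arc-irreflexive : ∀ {x y} → T x y ≡ true → ¬ x ≡ y
    arc-irreflexive {x} Txy refl with () ← trans (sym Txy) (proj₂ simple x)

    positive⇒arc : ∀ {x y} → 0ℚ ℚ.< g x y → T x y ≡ true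
    positive⇒arc {x} {y} 0<g with T x y in Txy
    ... | true  = refl
    ... | false = ⊥-elim (<-irrefl (sym (supported x y Txy)) 0<g)

    negate-< : ∀ {x y} → 0ℚ ℚ.< g x y → g y x ℚ.< 0ℚ
    negate-< {x} {y} 0<g = subst (ℚ._< 0ℚ) (sym (antisymmetric y x)) (neg-antimono-< 0<g)

    negate-> : ∀ {x y} → g x y ℚ.< 0ℚ → 0ℚ ℚ.< g y x
    negate-> {x} {y} g<0 = subst (0ℚ ℚ.<_) (sym (antisymmetric y x)) (neg-antimono-< g<0)

    flip-arc : ∀ {x y} → T x y ≡ true → T y x ≡ true
    flip-arc {x} {y} Txy = trans (proj₁ simple y x) Txy

    arc-path : ∀ {x y} → T x y ≡ true → IsPath T x y (x ∷ y ∷ [])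
    arc-path Txy = edge-path Txy (arc-irreflexive Txy)

    n<2+n : n ℕ.< 2 ℕ.+ n
    n<2+n = ℕₚ.m<n+m n ℕ.z<s

  -- Conservation at y balances the negative arc (y , y′) by a positive arc (y , z). Prepending z
  -- extends the path, since z on the path would close a cycle; so paths would grow beyond n vertices.
  no-negative-path : ∀ fuel {y y′ x rest} → IsPath T y x (y ∷ y′ ∷ rest) → g y y′ ℚ.< 0ℚ →
                     n ℕ.< length (y ∷ y′ ∷ rest) ℕ.+ fuel → ⊥
  no-negative-path zero path _ long =
    ℕₚ.<-irrefl refl (ℕₚ.<-≤-trans (subst (n ℕ.<_) (ℕₚ.+-identityʳ _) long) (length-unique-≤ _ (proj₂ path)))
  no-negative-path (suc fuel) {y} {y′} {x} {rest} path@(step Tyy′ walk , y∉ ∷ unique) g<0 long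
    with z , 0<g ← ∃-positive-term (g y) y′ (conserved y refl) g<0
       | y ≟ᶠ z | z ∈? (y′ ∷ rest)
  ... | yes refl | _ = arc-irreflexive (positive⇒arc 0<g) refl
  ... | no _ | yes (here refl) = <-asym g<0 0<g
  ... | no y≢z | no z∉path =
    no-negative-path fuel (step (flip-arc (positive⇒arc 0<g)) (proj₁ path) ,
                           All.¬Any⇒All¬ (y ∷ y′ ∷ rest) (λ { (here z≡y) → y≢z (sym z≡y) ; (there z∈) → z∉path z∈ }) ∷ proj₂ path)
                     (negate-< 0<g) (subst (n ℕ.<_) (ℕₚ.+-suc _ fuel) long)
  ... | no _ | yes (there z∈rest)
    with q , (walk′ , unique′) , q⊆path ← path-prefix (walk , unique) (there z∈rest) =
    acyclic (y , z , y ∷ q ,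
             (step Tyy′ walk′ , All.¬Any⇒All¬ q (λ y∈q → Unique[x∷xs]⇒x∉xs (y∉ ∷ unique) (q⊆path y∈q)) ∷ unique′) ,
             ℕ.s≤s (walk-length walk′ (y′≢z ∘ trans (sym (walk-head walk)))) , flip-arc (positive⇒arc 0<g))
    where
    y′≢z : ¬ y′ ≡ z
    y′≢z refl = <-asym g<0 0<g

  circulation-≡0 : ∀ u v → g u v ≡ 0ℚ
  circulation-≡0 u v with <-cmp (g u v) 0ℚ
  ... | tri≈ _ g≡0 _ = g≡0
  ... | tri< g<0 _ _ = ⊥-elim (no-negative-path n (arc-path (flip-arc (positive⇒arc (negate-> g<0)))) g<0 n<2+n)
  ... | tri> _ _ 0<g = ⊥-elim (no-negative-path n (arc-path (flip-arc (positive⇒arc 0<g))) (negate-< 0<g) n<2+n)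

_≈ᵉ_ : ∀ {n} → Fin n × Fin n → Fin n × Fin n → Set
(x , y) ≈ᵉ (u , v) = (x ≡ u × y ≡ v) ⊎ (x ≡ v × y ≡ u)

≈ᵉ-sym : ∀ {n} {d e : Fin n × Fin n} → d ≈ᵉ e → e ≈ᵉ d
≈ᵉ-sym (inj₁ (refl , refl)) = inj₁ (refl , refl)
≈ᵉ-sym (inj₂ (refl , refl)) = inj₂ (refl , refl)

≈ᵉ-trans : ∀ {n} {d e f : Fin n × Fin n} → d ≈ᵉ e → e ≈ᵉ f → d ≈ᵉ f
≈ᵉ-trans (inj₁ (refl , refl)) e≈f                  = e≈f
≈ᵉ-trans (inj₂ (refl , refl)) (inj₁ (refl , refl)) = inj₂ (refl , refl)
≈ᵉ-trans (inj₂ (refl , refl)) (inj₂ (refl , refl)) = inj₁ (refl , refl)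

oriented-≈ᵉ : ∀ {n} b (e : Fin n × Fin n) → oriented b e ≈ᵉ e
oriented-≈ᵉ true  _ = inj₁ (refl , refl)
oriented-≈ᵉ false _ = inj₂ (refl , refl)

≈ᵉ-arc : ∀ {n} {G : Graph n} → (∀ u v → G u v ≡ G v u) → ∀ {x y u v} → (x , y) ≈ᵉ (u , v) → G x y ≡ G u v
≈ᵉ-arc G-sym (inj₁ (refl , refl)) = refl
≈ᵉ-arc G-sym (inj₂ (refl , refl)) = G-sym _ _

≈ᵉ-antisymmetric : ∀ {n} {g : ArcVec n} → Antisymmetric g → ∀ {x y u v} → (x , y) ≈ᵉ (u , v) → g x y ≡ 0ℚ → g u v ≡ 0ℚ
≈ᵉ-antisymmetric antisym (inj₁ (refl , refl)) gxy≡0 = gxy≡0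
≈ᵉ-antisymmetric antisym (inj₂ (refl , refl)) gxy≡0 = trans (antisym _ _) (cong -_ gxy≡0)

edgeVec : ∀ {n} → Fin n → Fin n → ArcVec n
edgeVec x y u v = δ (eqᵇ x u ∧ eqᵇ y v) - δ (eqᵇ x v ∧ eqᵇ y u)

edgeSum : ∀ {n} → List (Fin n) → ArcVec n
edgeSum (x ∷ y ∷ xs) u v = edgeVec x y u v + edgeSum (y ∷ xs) u v
edgeSum _            u v = 0ℚ

edgeVec-antisymmetric : ∀ {n} (x y : Fin n) → Antisymmetric (edgeVec x y)
edgeVec-antisymmetric x y u v =
  solve 2 (λ a b → a :- b := :- (b :- a)) refl (δ (eqᵇ x u ∧ eqᵇ y v)) (δ (eqᵇ x v ∧ eqᵇ y u))

edgeVec-outflow : ∀ {n} (x y u : Fin n) → outflow (edgeVec x y) u ≡ δ (eqᵇ x u) - δ (eqᵇ y u)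
edgeVec-outflow x y u = begin
  (Σᶠ λ v → δ (eqᵇ x u ∧ eqᵇ y v) - δ (eqᵇ x v ∧ eqᵇ y u))
    ≡⟨ Σᶠ-distrib-- (λ v → δ (eqᵇ x u ∧ eqᵇ y v)) (λ v → δ (eqᵇ x v ∧ eqᵇ y u)) ⟩
  (Σᶠ λ v → δ (eqᵇ x u ∧ eqᵇ y v)) - (Σᶠ λ v → δ (eqᵇ x v ∧ eqᵇ y u))
    ≡⟨ cong₂ _-_ (trans (δ-∧-constˡ (eqᵇ x u) (eqᵇ y)) (Σᶠ-δʳ y (λ _ → δ (eqᵇ x u))))
                 (trans (δ-∧-constʳ (eqᵇ y u) (eqᵇ x)) (Σᶠ-δʳ x (λ _ → δ (eqᵇ y u)))) ⟩
  δ (eqᵇ x u) - δ (eqᵇ y u)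
    ∎
  where
  δ-∧-constˡ : ∀ c (P : Fin _ → Bool) → Σᶠ (λ v → δ (c ∧ P v)) ≡ Σᶠ (λ v → δ (P v) * δ c)
  δ-∧-constˡ c P = Σᶠ-cong λ v → trans (δ-∧ c (P v)) (*-comm (δ c) (δ (P v)))
  δ-∧-constʳ : ∀ c (P : Fin _ → Bool) → Σᶠ (λ v → δ (P v ∧ c)) ≡ Σᶠ (λ v → δ (P v) * δ c)
  δ-∧-constʳ c P = Σᶠ-cong λ v → δ-∧ (P v) c

edgeVec-≉ : ∀ {n} {x y u v : Fin n} → ¬ (x , y) ≈ᵉ (u , v) → edgeVec x y u v ≡ 0ℚ
edgeVec-≉ x,y≉u,v = cong₂ _-_ (δ-pair-≡0 (x,y≉u,v ∘ inj₁)) (δ-pair-≡0 (x,y≉u,v ∘ inj₂))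

edgeVec-self : ∀ {n} {x y : Fin n} → ¬ x ≡ y → edgeVec x y x y ≡ 1ℚ
edgeVec-self {x = x} {y} x≢y rewrite eqᵇ-refl x | eqᵇ-refl y | eqᵇ-≢ x≢y = refl

edgeVec-supported : ∀ {n} {G : Graph n} → (∀ u v → G u v ≡ G v u) →
                    ∀ {x y} → G x y ≡ true → SupportedOn G (edgeVec x y)
edgeVec-supported G-sym {x} {y} Gxy u v Guv = edgeVec-≉ {x = x} {y} {u} {v} λ
  { (inj₁ (refl , refl)) → case trans (sym Gxy) Guv of λ ()
  ; (inj₂ (refl , refl)) → case trans (sym Gxy) (trans (G-sym x y) Guv) of λ () }

stepIn-∷ : ∀ {n} (x y : Fin n) xs {u v} → stepIn (x ∷ y ∷ xs) u v ≡ true → (x ≡ u × y ≡ v) ⊎ stepIn (y ∷ xs) u v ≡ true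
stepIn-∷ x y xs {u} {v} uv-step with eqᵇ x u ∧ eqᵇ y v in x,y≡u,v
... | true  = inj₁ (eqᵇ-pair⇒≡ x y u v x,y≡u,v)
... | false = inj₂ uv-step

stepIn⇒∈ : ∀ {n} (xs : List (Fin n)) {u v} → stepIn xs u v ≡ true → u ∈ xs
stepIn⇒∈ (x ∷ y ∷ xs) uv-step =
  [ (λ { (refl , _) → here refl }) , there ∘ stepIn⇒∈ (y ∷ xs) ]′ (stepIn-∷ x y xs uv-step)

stepIn⇒∈-tail : ∀ {n} (x : Fin n) xs {u v} → stepIn (x ∷ xs) u v ≡ true → v ∈ xs
stepIn⇒∈-tail x (y ∷ xs) uv-step =
  [ (λ { (_ , refl) → here refl }) , there ∘ stepIn⇒∈-tail y xs ]′ (stepIn-∷ x y xs uv-step)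

stepIn⇒arc : ∀ {n} {G : Graph n} {a b xs} → Walk G a b xs → ∀ {u v} → stepIn xs u v ≡ true → G u v ≡ true
stepIn⇒arc (step {u = x} {w = y} Gxy (stop y)) uv-step =
  [ (λ { (refl , refl) → Gxy }) , (λ ()) ]′ (stepIn-∷ x y [] uv-step)
stepIn⇒arc (step {u = x} {w = y} Gxy walk@(step {xs = xs} _ _)) uv-step =
  [ (λ { (refl , refl) → Gxy }) , stepIn⇒arc walk ]′ (stepIn-∷ x y xs uv-step)

if-∨ : ∀ a b s t → (a ≡ true → s ≡ false × t ≡ false) → (b ≡ true → s ≡ false × t ≡ false) → (a ≡ true → b ≡ false) →
       (if a ∨ s then 1ℚ else if b ∨ t then - 1ℚ else 0ℚ) ≡ (δ a - δ b) + (if s then 1ℚ else if t then - 1ℚ else 0ℚ)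
if-∨ true  b     s t a⇒s,t _ a⇒¬b with a⇒s,t refl | a⇒¬b refl
... | refl , refl | refl = refl
if-∨ false true  s t _ b⇒s,t _ with b⇒s,t refl
... | refl , refl = refl
if-∨ false false s t _ _     _ = sym (+-identityˡ _)

walkVec-∷ : ∀ {n} {x y : Fin n} {xs} → ¬ x ≡ y → stepIn (y ∷ xs) x y ≡ false → stepIn (y ∷ xs) y x ≡ false →
            ∀ u v → walkVec (x ∷ y ∷ xs) u v ≡ edgeVec x y u v + walkVec (y ∷ xs) u v
walkVec-∷ {x = x} {y} {xs} x≢y xy∉ yx∉ u v =
  if-∨ (eqᵇ x u ∧ eqᵇ y v) (eqᵇ x v ∧ eqᵇ y u) (stepIn (y ∷ xs) u v) (stepIn (y ∷ xs) v u)
       (λ eq → case eqᵇ-pair⇒≡ x y u v eq of λ { (refl , refl) → xy∉ , yx∉ })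
       (λ eq → case eqᵇ-pair⇒≡ x y v u eq of λ { (refl , refl) → yx∉ , xy∉ })
       (λ eq → case eqᵇ-pair⇒≡ x y u v eq of λ { (refl , refl) → ¬-not (x≢y ∘ proj₁ ∘ eqᵇ-pair⇒≡ x y y x) })

walkVec-unique : ∀ {n} (xs : List (Fin n)) → Unique xs → ∀ u v → walkVec xs u v ≡ edgeSum xs u v
walkVec-unique []           _                   u v = refl
walkVec-unique (x ∷ [])     _                   u v = refl
walkVec-unique (x ∷ y ∷ xs) unique@(_ ∷ unique′) u v =
  trans (walkVec-∷ {xs = xs} (x∉ ∘ here) (¬-not (x∉ ∘ stepIn⇒∈ (y ∷ xs))) (¬-not (x∉ ∘ there ∘ stepIn⇒∈-tail y xs)) u v)
        (cong (edgeVec x y u v +_) (walkVec-unique (y ∷ xs) unique′ u v))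
  where
  x∉ : x ∉ y ∷ xs
  x∉ = Unique[x∷xs]⇒x∉xs unique

edgeSum-antisymmetric : ∀ {n} (xs : List (Fin n)) → Antisymmetric (edgeSum xs)
edgeSum-antisymmetric []           u v = refl
edgeSum-antisymmetric (x ∷ [])     u v = refl
edgeSum-antisymmetric (x ∷ y ∷ xs) u v =
  trans (cong₂ _+_ (edgeVec-antisymmetric x y u v) (edgeSum-antisymmetric (y ∷ xs) u v))
        (sym (neg-distrib-+ (edgeVec x y v u) (edgeSum (y ∷ xs) v u)))

module _ {n} {G : Graph n} where

  edgeSum-step : ∀ {y b xs} → Walk G y b xs → ∀ x u v → edgeSum (x ∷ xs) u v ≡ edgeVec x y u v + edgeSum xs u v
  edgeSum-step (stop _)   x u v = refl
  edgeSum-step (step _ _) x u v = refl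

  edgeSum-supported : (∀ u v → G u v ≡ G v u) → ∀ {a b xs} → Walk G a b xs → SupportedOn G (edgeSum xs)
  edgeSum-supported G-sym (stop _)               u v Guv = refl
  edgeSum-supported G-sym (step {u = x} {w = y} {xs = xs} Gxy walk) u v Guv = begin
    edgeSum (x ∷ xs) u v                ≡⟨ edgeSum-step walk x u v ⟩
    edgeVec x y u v + edgeSum xs u v    ≡⟨ cong₂ _+_ (edgeVec-supported G-sym Gxy u v Guv) (edgeSum-supported G-sym walk u v Guv) ⟩
    0ℚ + 0ℚ                             ≡⟨⟩
    0ℚ                                  ∎

  edgeSum-outflow : ∀ {a b xs} → Walk G a b xs → ∀ u → outflow (edgeSum xs) u ≡ δ (eqᵇ a u) - δ (eqᵇ b u)
  edgeSum-outflow (stop a) u = trans (Σᶠ-zero {n} {f = λ _ → 0ℚ} (λ _ → refl)) (sym (+-inverseʳ (δ (eqᵇ a u))))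
  edgeSum-outflow {b = b} (step {u = x} {w = y} {xs = xs} Gxy walk) u = begin
    outflow (edgeSum (x ∷ xs)) u
      ≡⟨ Σᶠ-cong (edgeSum-step walk x u) ⟩
    (Σᶠ λ v → edgeVec x y u v + edgeSum xs u v)
      ≡⟨ Σᶠ-distrib-+ (edgeVec x y u) (edgeSum xs u) ⟩
    outflow (edgeVec x y) u + outflow (edgeSum xs) u
      ≡⟨ cong₂ _+_ (edgeVec-outflow x y u) (edgeSum-outflow walk u) ⟩
    (δ (eqᵇ x u) - δ (eqᵇ y u)) + (δ (eqᵇ y u) - δ (eqᵇ b u))
      ≡⟨ solve 3 (λ p q r → (p :- q) :+ (q :- r) := p :- r) refl (δ (eqᵇ x u)) (δ (eqᵇ y u)) (δ (eqᵇ b u)) ⟩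
    δ (eqᵇ x u) - δ (eqᵇ b u)
      ∎

  walkVec-closing : ∀ {h t l} → IsPath G h t l → ¬ t ≡ h → G h t ≡ false →
                    ∀ u v → walkVec (t ∷ l) u v ≡ edgeSum (t ∷ l) u v
  walkVec-closing (stop _ , _) t≢h _ = ⊥-elim (t≢h refl)
  walkVec-closing {h} {t} (walk@(step {xs = xs} _ _) , unique) t≢h Ght u v =
    trans (walkVec-∷ {xs = xs} t≢h (¬-not (h∉xs ∘ stepIn⇒∈-tail h xs)) (¬-not ht∉) u v)
          (cong (edgeVec t h u v +_) (walkVec-unique (h ∷ xs) unique u v))
    where
    h∉xs : h ∉ xs
    h∉xs = Unique[x∷xs]⇒x∉xs unique
    ht∉ : ¬ stepIn (h ∷ xs) h t ≡ true
    ht∉ ht-step with () ← trans (sym (stepIn⇒arc walk ht-step)) Ght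

walk-mono : ∀ {n} {G H : Graph n} → (∀ u v → G u v ≡ true → H u v ≡ true) → ∀ {a b xs} → Walk G a b xs → Walk H a b xs
walk-mono G⊆H (stop a)        = stop a
walk-mono G⊆H (step Gab walk) = step (G⊆H _ _ Gab) (walk-mono G⊆H walk)

record IsLinear {n} (φ : ArcVec n → ℚ) : Set where
  field
    ≗-cong   : ∀ {f g} → (∀ u v → f u v ≡ g u v) → φ f ≡ φ g
    *-+-homo : ∀ α f g → φ (λ u v → α * f u v + g u v) ≡ α * φ f + φ g
    0-homo   : φ (λ _ _ → 0ℚ) ≡ 0ℚ

module _ {n} {φ : ArcVec n → ℚ} (linear : IsLinear φ) where
  open IsLinear linear

  lincomb-annihilated : ∀ zs → All (λ z → φ z ≡ 0ℚ) zs → ∀ c → φ (lincomb zs c) ≡ 0ℚ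
  lincomb-annihilated []       []           c = 0-homo
  lincomb-annihilated (z ∷ zs) (φz≡0 ∷ φzs≡0) c = begin
    φ (lincomb (z ∷ zs) c)                                  ≡⟨ *-+-homo (c F.zero) z (lincomb zs (c ∘ F.suc)) ⟩
    c F.zero * φ z + φ (lincomb zs (c ∘ F.suc))             ≡⟨ cong₂ (λ a b → c F.zero * a + b) φz≡0 (lincomb-annihilated zs φzs≡0 (c ∘ F.suc)) ⟩
    c F.zero * 0ℚ + 0ℚ                                      ≡⟨ trans (+-identityʳ _) (*-zeroʳ (c F.zero)) ⟩
    0ℚ                                                      ∎

  linIndep-∷ : ∀ {z zs} → ¬ φ z ≡ 0ℚ → All (λ w → φ w ≡ 0ℚ) zs → LinIndep zs → LinIndep (z ∷ zs)
  linIndep-∷ {z} {zs} φz≢0 φzs≡0 indep c combination≡0 = coefficients≡0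
    where
    c₀≡0 : c F.zero ≡ 0ℚ
    c₀≡0 = *-cancelˡ-≢0 (φ z) φz≢0 (begin
      φ z * c F.zero                               ≡⟨ *-comm (φ z) (c F.zero) ⟩
      c F.zero * φ z                               ≡⟨ +-identityʳ _ ⟨
      c F.zero * φ z + 0ℚ                          ≡⟨ cong (c F.zero * φ z +_) (lincomb-annihilated zs φzs≡0 (c ∘ F.suc)) ⟨
      c F.zero * φ z + φ (lincomb zs (c ∘ F.suc))  ≡⟨ *-+-homo (c F.zero) z (lincomb zs (c ∘ F.suc)) ⟨
      φ (lincomb (z ∷ zs) c)                       ≡⟨ ≗-cong combination≡0 ⟩
      φ (λ _ _ → 0ℚ)                               ≡⟨ 0-homo ⟩
      0ℚ                                           ≡⟨ *-zeroʳ (φ z) ⟨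
      φ z * 0ℚ                                     ∎)
    tail≡0 : ∀ u v → lincomb zs (c ∘ F.suc) u v ≡ 0ℚ
    tail≡0 u v = begin
      lincomb zs (c ∘ F.suc) u v                   ≡⟨ +-identityˡ _ ⟨
      0ℚ + lincomb zs (c ∘ F.suc) u v              ≡⟨ cong (_+ lincomb zs (c ∘ F.suc) u v) (trans (cong (_* z u v) c₀≡0) (*-zeroˡ (z u v))) ⟨
      c F.zero * z u v + lincomb zs (c ∘ F.suc) u v ≡⟨ combination≡0 u v ⟩
      0ℚ                                           ∎
    coefficients≡0 : ∀ i → c i ≡ 0ℚ
    coefficients≡0 F.zero    = c₀≡0
    coefficients≡0 (F.suc i) = indep (c ∘ F.suc) tail≡0 i

evaluation-linear : ∀ {n} (p q : Fin n) → IsLinear (λ f → f p q)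
evaluation-linear p q = record { ≗-cong = λ f≗g → f≗g p q ; *-+-homo = λ _ _ _ → refl ; 0-homo = refl }

outflow-linear : ∀ {n} (w : Fin n) → IsLinear (λ f → outflow f w)
outflow-linear {n} w = record
  { ≗-cong   = λ f≗g → Σᶠ-cong (f≗g w)
  ; *-+-homo = λ α f g → trans (Σᶠ-distrib-+ (λ v → α * f w v) (g w)) (cong (_+ outflow g w) (sym (*-distribˡ-Σᶠ α (f w))))
  ; 0-homo   = Σᶠ-zero {n} (λ _ → refl)
  }

neg-linear : ∀ {n} {φ : ArcVec n → ℚ} → IsLinear φ → IsLinear (λ f → - φ f)
neg-linear linear = record
  { ≗-cong   = cong -_ ∘ ≗-cong
  ; *-+-homo = λ α f g → trans (cong -_ (*-+-homo α f g))
                               (solve 3 (λ α x y → :- (α :* x :+ y) := α :* (:- x) :+ (:- y)) refl α _ _)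
  ; 0-homo   = cong -_ 0-homo
  }
  where open IsLinear linear

-linear : ∀ {n} {φ ψ : ArcVec n → ℚ} → IsLinear φ → IsLinear ψ → IsLinear (λ f → φ f - ψ f)
-linear φ-linear ψ-linear = record
  { ≗-cong   = λ f≗g → cong₂ _-_ (φ.≗-cong f≗g) (ψ.≗-cong f≗g)
  ; *-+-homo = λ α f g → trans (cong₂ _-_ (φ.*-+-homo α f g) (ψ.*-+-homo α f g))
      (solve 5 (λ α p q r s → (α :* p :+ q) :- (α :* r :+ s) := α :* (p :- r) :+ (q :- s)) refl α _ _ _ _)
  ; 0-homo   = cong₂ _-_ φ.0-homo ψ.0-homo
  }
  where
  module φ = IsLinear φ-linear
  module ψ = IsLinear ψ-linear

Σˡ : ∀ {A : Set} → List A → (A → ℚ) → ℚ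
Σˡ []       H = 0ℚ
Σˡ (x ∷ xs) H = H x + Σˡ xs H

module _ {A : Set} where

  Σˡ-cong : ∀ (xs : List A) {H H′} → (∀ {x} → x ∈ xs → H x ≡ H′ x) → Σˡ xs H ≡ Σˡ xs H′
  Σˡ-cong []       H≗H′ = refl
  Σˡ-cong (x ∷ xs) H≗H′ = cong₂ _+_ (H≗H′ (here refl)) (Σˡ-cong xs (H≗H′ ∘ there))

  Σˡ-zero : ∀ (xs : List A) {H} → (∀ {x} → x ∈ xs → H x ≡ 0ℚ) → Σˡ xs H ≡ 0ℚ
  Σˡ-zero []       H≗0 = refl
  Σˡ-zero (x ∷ xs) H≗0 = cong₂ _+_ (H≗0 (here refl)) (Σˡ-zero xs (H≗0 ∘ there))

  Σˡ-concentrated : ∀ (xs : List A) {H b} → Unique xs → b ∈ xs → (∀ {x} → x ∈ xs → ¬ x ≡ b → H x ≡ 0ℚ) → Σˡ xs H ≡ H b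
  Σˡ-concentrated (x ∷ xs) {H} unique (here refl) H≗0 =
    trans (cong (H x +_) (Σˡ-zero xs (λ x′∈xs → H≗0 (there x′∈xs) λ { refl → Unique[x∷xs]⇒x∉xs unique x′∈xs }))) (+-identityʳ (H x))
  Σˡ-concentrated (x ∷ xs) {H} {b} unique@(_ ∷ unique′) (there b∈xs) H≗0 =
    trans (cong₂ _+_ (H≗0 (here refl) λ { refl → Unique[x∷xs]⇒x∉xs unique b∈xs }) (Σˡ-concentrated xs unique′ b∈xs (H≗0 ∘ there)))
          (+-identityˡ (H b))

Σˡ-linear : ∀ {n} {A : Set} (xs : List A) {ψ : A → ArcVec n → ℚ} (r : A → ℚ) → (∀ x → IsLinear (ψ x)) →
            IsLinear (λ f → Σˡ xs (λ x → ψ x f * r x))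
Σˡ-linear []       r linear = record { ≗-cong = λ _ → refl ; *-+-homo = λ α _ _ → sym (trans (+-identityʳ _) (*-zeroʳ α)) ; 0-homo = refl }
Σˡ-linear (x ∷ xs) {ψ} r linear = record
  { ≗-cong   = λ f≗g → cong₂ _+_ (cong (_* r x) (ψx.≗-cong f≗g)) (rest.≗-cong f≗g)
  ; *-+-homo = λ α f g → trans (cong₂ _+_ (cong (_* r x) (ψx.*-+-homo α f g)) (rest.*-+-homo α f g))
      (solve 6 (λ α p q r s t → (α :* p :+ q) :* r :+ (α :* s :+ t) := α :* (p :* r :+ s) :+ (q :* r :+ t))
             refl α _ _ (r x) _ _)
  ; 0-homo   = trans (cong₂ _+_ (cong (_* r x) ψx.0-homo) rest.0-homo) (trans (+-identityʳ _) (*-zeroˡ (r x)))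
  }
  where
  module ψx = IsLinear (linear x)
  module rest = IsLinear (Σˡ-linear xs r linear)

combination : ∀ {n} {A : Set} → List A → (A → ℚ) → (A → ArcVec n) → ArcVec n
combination xs c z u v = Σˡ xs (λ x → c x * z x u v)

module _ {n} {φ : ArcVec n → ℚ} (linear : IsLinear φ) where
  open IsLinear linear

  combination-linear : ∀ {A : Set} (xs : List A) c z → φ (combination xs c z) ≡ Σˡ xs (λ x → c x * φ (z x))
  combination-linear []       c z = 0-homo
  combination-linear (x ∷ xs) c z =
    trans (*-+-homo (c x) (z x) (combination xs c z)) (cong (c x * φ (z x) +_) (combination-linear xs c z))

module _ {n} {G : Graph n} where

  combination-supported : ∀ {A : Set} (xs : List A) c z → (∀ {x} → x ∈ xs → SupportedOn G (z x)) →
                          SupportedOn G (combination xs c z)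
  combination-supported xs c z supported u v Guv =
    Σˡ-zero xs (λ {x} x∈xs → trans (cong (c x *_) (supported x∈xs u v Guv)) (*-zeroʳ (c x)))

combination-antisymmetric : ∀ {n} {A : Set} (xs : List A) c (z : A → ArcVec n) → (∀ {x} → x ∈ xs → Antisymmetric (z x)) →
                            Antisymmetric (combination xs c z)
combination-antisymmetric []       c z antisym u v = refl
combination-antisymmetric (x ∷ xs) c z antisym u v = begin
  c x * z x u v + combination xs c z u v           ≡⟨ cong₂ (λ p q → c x * p + q) (antisym (here refl) u v)
                                                             (combination-antisymmetric xs c z (antisym ∘ there) u v) ⟩
  c x * - z x v u + - combination xs c z v u       ≡⟨ solve 3 (λ c z r → c :* (:- z) :+ (:- r) := :- (c :* z :+ r)) refl
                                                        (c x) (z x v u) (combination xs c z v u) ⟩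
  - (c x * z x v u + combination xs c z v u)       ∎

lincomb-map-++ : ∀ {n} {A B : Set} (z : A → ArcVec n) (w : B → ArcVec n) xs ys c d →
                 ∃ λ cs → ∀ u v → lincomb (map z xs ++ map w ys) cs u v ≡ combination xs c z u v + combination ys d w u v
lincomb-map-++ z w []       []       c d = (λ ()) , λ u v → refl
lincomb-map-++ z w []       (y ∷ ys) c d with cs , eq ← lincomb-map-++ z w [] ys c d =
  d y ∷ᵛ cs , λ u v → trans (cong (d y * w y u v +_) (trans (eq u v) (+-identityˡ _)))
                            (sym (+-identityˡ (combination (y ∷ ys) d w u v)))
lincomb-map-++ z w (x ∷ xs) ys       c d with cs , eq ← lincomb-map-++ z w xs ys c d =
  c x ∷ᵛ cs , λ u v → trans (cong (c x * z x u v +_) (eq u v)) (sym (+-assoc (c x * z x u v) _ _))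

module _ {A : Set} (p : A → Bool) where
  open Equivalence

  ∈-filterᵇ⁻ : ∀ {x xs} → x ∈ filterᵇ p xs → T (p x)
  ∈-filterᵇ⁻ {xs = xs} x∈ = proj₂ (∈-filter⁻ (T? ∘ p) {xs = xs} x∈)

  ∈-filterᵇ⁺ : ∀ {x xs} → x ∈ xs → T (p x) → x ∈ filterᵇ p xs
  ∈-filterᵇ⁺ = ∈-filter⁺ (T? ∘ p)

  filterᵇ-unique : ∀ {xs} → Unique xs → Unique (filterᵇ p xs)
  filterᵇ-unique = filter⁺ (T? ∘ p)

module _ {n} (X T : Graph n) where
  open Equivalence

  ∈-nonTreeEdges⁻ : ∀ {u v} → (u , v) ∈ nonTreeEdges X T → toℕ u ℕ.< toℕ v × X u v ≡ true × T u v ≡ false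
  ∈-nonTreeEdges⁻ {u} {v} uv∈ with u<v , Xuv∧¬Tuv ← to T-∧ (∈-filterᵇ⁻ _ {xs = cartesianProduct (allFin n) (allFin n)} uv∈) with Xuv , ¬Tuv ← to T-∧ Xuv∧¬Tuv =
    ℕₚ.<ᵇ⇒< (toℕ u) (toℕ v) u<v , to T-≡ Xuv , to T-not-≡ ¬Tuv

  ∈-nonTreeEdges⁺ : ∀ {u v} → toℕ u ℕ.< toℕ v → X u v ≡ true → T u v ≡ false → (u , v) ∈ nonTreeEdges X T
  ∈-nonTreeEdges⁺ {u} {v} u<v Xuv Tuv = ∈-filterᵇ⁺ _ (∈-cartesianProduct⁺ (∈-allFin u) (∈-allFin v))
    (from T-∧ (ℕₚ.<⇒<ᵇ u<v , from T-∧ (from T-≡ Xuv , from T-not-≡ Tuv)))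

  nonTreeEdges-unique : Unique (nonTreeEdges X T)
  nonTreeEdges-unique = filterᵇ-unique _ (cartesianProduct⁺ (allFin⁺ n) (allFin⁺ n))

module _ {n} (S : Fin n → Bool) (a : Fin n) where
  open Equivalence

  ∈-otherMarked⁻ : ∀ {b} → b ∈ otherMarked S a → S b ≡ true × ¬ b ≡ a
  ∈-otherMarked⁻ {b} b∈ with Sb , b≢a ← to T-∧ (∈-filterᵇ⁻ (λ b → S b ∧ not (eqᵇ b a)) {xs = allFin n} b∈) =
    to T-≡ Sb , λ { refl → case trans (sym (to T-not-≡ b≢a)) (eqᵇ-refl b) of λ () }

  ∈-otherMarked⁺ : ∀ {b} → S b ≡ true → ¬ b ≡ a → b ∈ otherMarked S a
  ∈-otherMarked⁺ {b} Sb b≢a = ∈-filterᵇ⁺ (λ b → S b ∧ not (eqᵇ b a)) (∈-allFin b) (from T-∧ (from T-≡ Sb , from T-not-≡ (eqᵇ-≢ b≢a)))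

  otherMarked-unique : Unique (otherMarked S a)
  otherMarked-unique = filterᵇ-unique (λ b → S b ∧ not (eqᵇ b a)) (allFin⁺ n)

-- The basis

module FundamentalBasis
  {n k : ℕ} {X : Graph n} (simple : IsSimple X) (regular : IsRegular X k) (connected : IsConnected X)
  {S : Fin n → Bool} {T : Graph n} (spanning : IsSpanningTree X T) {a : Fin n} (Sa : S a ≡ true)
  (orient : Fin n × Fin n → Bool) (cyc : Fin n × Fin n → List (Fin n))
  (cyc-path : ∀ e → e ∈ nonTreeEdges X T →
              IsPath T (headOf (oriented (orient e) e)) (tailOf (oriented (orient e) e)) (cyc e))
  (pth : Fin n → List (Fin n)) (pth-path : ∀ b → b ∈ otherMarked S a → IsPath X a b (pth b)) where

  open Walk-matrices X k S using (InEigen1)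

  E : List (Fin n × Fin n)
  E = nonTreeEdges X T

  B : List (Fin n)
  B = otherMarked S a

  tl hd : Fin n × Fin n → Fin n
  tl e = tailOf (oriented (orient e) e)
  hd e = headOf (oriented (orient e) e)

  ze : Fin n × Fin n → ArcVec n
  ze e = walkVec (tl e ∷ cyc e)

  zb : Fin n → ArcVec n
  zb b = walkVec (pth b)

  X-sym : ∀ u v → X u v ≡ X v u
  X-sym = proj₁ simple

  T-sym : ∀ u v → T u v ≡ T v u
  T-sym = proj₁ spanning

  T⊆X : ∀ u v → T u v ≡ true → X u v ≡ true
  T⊆X = proj₁ (proj₂ spanning)

  X-irreflexive : ∀ {u v} → X u v ≡ true → ¬ u ≡ v
  X-irreflexive {u} Xuv refl with () ← trans (sym Xuv) (proj₂ simple u)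

  T-simple : IsSimple T
  T-simple = T-sym , λ u → ¬-not (λ Tuu → X-irreflexive (T⊆X u u Tuu) refl)

  oriented-≈ : ∀ e → (tl e , hd e) ≈ᵉ e
  oriented-≈ e = oriented-≈ᵉ (orient e) e

  module _ {e} (e∈E : e ∈ E) where

    X-oriented : X (tl e) (hd e) ≡ true
    X-oriented = trans (≈ᵉ-arc X-sym (oriented-≈ e)) (proj₁ (proj₂ (∈-nonTreeEdges⁻ X T e∈E)))

    T-oriented : T (tl e) (hd e) ≡ false
    T-oriented = trans (≈ᵉ-arc T-sym (oriented-≈ e)) (proj₂ (proj₂ (∈-nonTreeEdges⁻ X T e∈E)))

    tl≢hd : ¬ tl e ≡ hd e
    tl≢hd = X-irreflexive X-oriented

    ze≗edgeSum : ∀ u v → ze e u v ≡ edgeSum (tl e ∷ cyc e) u v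
    ze≗edgeSum = walkVec-closing (cyc-path e e∈E) tl≢hd (trans (T-sym (hd e) (tl e)) T-oriented)

    cycle-walk : Walk X (tl e) (tl e) (tl e ∷ cyc e)
    cycle-walk = step X-oriented (walk-mono T⊆X (proj₁ (cyc-path e e∈E)))

    ze-outflow : ∀ w → outflow (ze e) w ≡ 0ℚ
    ze-outflow w = trans (Σᶠ-cong (ze≗edgeSum w)) (trans (edgeSum-outflow cycle-walk w) (+-inverseʳ (δ (eqᵇ (tl e) w))))

    ze-flow : IsFlow X S (ze e)
    ze-flow = record
      { supported     = λ u v Xuv → trans (ze≗edgeSum u v) (edgeSum-supported X-sym cycle-walk u v Xuv)
      ; antisymmetric = λ u v → trans (ze≗edgeSum u v) (trans (edgeSum-antisymmetric (tl e ∷ cyc e) u v) (cong -_ (sym (ze≗edgeSum v u))))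
      ; conserved     = λ w _ → ze-outflow w
      }

    -- the rest of the fundamental cycle lies in T
    ze-off-tree : ∀ {p q} → T p q ≡ false → ze e p q ≡ edgeVec (tl e) (hd e) p q
    ze-off-tree {p} {q} Tpq = begin
      ze e p q                                                ≡⟨ ze≗edgeSum p q ⟩
      edgeSum (tl e ∷ cyc e) p q                              ≡⟨ edgeSum-step (proj₁ (cyc-path e e∈E)) (tl e) p q ⟩
      edgeVec (tl e) (hd e) p q + edgeSum (cyc e) p q         ≡⟨ cong (edgeVec (tl e) (hd e) p q +_) (edgeSum-supported T-sym (proj₁ (cyc-path e e∈E)) p q Tpq) ⟩
      edgeVec (tl e) (hd e) p q + 0ℚ                          ≡⟨ +-identityʳ _ ⟩
      edgeVec (tl e) (hd e) p q                               ∎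

  module _ {b} (b∈B : b ∈ B) where

    zb≗edgeSum : ∀ u v → zb b u v ≡ edgeSum (pth b) u v
    zb≗edgeSum = walkVec-unique (pth b) (proj₂ (pth-path b b∈B))

    zb-outflow : ∀ w → outflow (zb b) w ≡ δ (eqᵇ a w) - δ (eqᵇ b w)
    zb-outflow w = trans (Σᶠ-cong (zb≗edgeSum w)) (edgeSum-outflow (proj₁ (pth-path b b∈B)) w)

    zb-flow : IsFlow X S (zb b)
    zb-flow = record
      { supported     = λ u v Xuv → trans (zb≗edgeSum u v) (edgeSum-supported X-sym (proj₁ (pth-path b b∈B)) u v Xuv)
      ; antisymmetric = λ u v → trans (zb≗edgeSum u v) (trans (edgeSum-antisymmetric (pth b) u v) (cong -_ (sym (zb≗edgeSum v u))))
      ; conserved     = λ w Sw → trans (zb-outflow w) (cong₂ (λ p q → δ p - δ q) (unmarked-≢ Sa Sw) (unmarked-≢ (proj₁ (∈-otherMarked⁻ S a b∈B)) Sw))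
      }
      where
      unmarked-≢ : ∀ {x w} → S x ≡ true → S w ≡ false → eqᵇ x w ≡ false
      unmarked-≢ Sx Sw = eqᵇ-≢ λ { refl → case trans (sym Sx) Sw of λ () }

  oriented-injective : ∀ {e e′} → e ∈ E → e′ ∈ E → (tl e′ , hd e′) ≈ᵉ (tl e , hd e) → e′ ≡ e
  oriented-injective {e} {e′} e∈E e′∈E arcs≈ with ≈ᵉ-trans (≈ᵉ-sym (oriented-≈ e′)) (≈ᵉ-trans arcs≈ (oriented-≈ e))
  ... | inj₁ (refl , refl) = refl
  ... | inj₂ (refl , refl) = ⊥-elim (ℕₚ.<-asym (proj₁ (∈-nonTreeEdges⁻ X T e∈E)) (proj₁ (∈-nonTreeEdges⁻ X T e′∈E)))

  nontree-arc : ∀ {u v} → X u v ≡ true → T u v ≡ false → ∃ λ e → e ∈ E × (tl e , hd e) ≈ᵉ (u , v)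
  nontree-arc {u} {v} Xuv Tuv with ℕₚ.<-cmp (toℕ u) (toℕ v)
  ... | tri< u<v _ _ = (u , v) , ∈-nonTreeEdges⁺ X T u<v Xuv Tuv , oriented-≈ (u , v)
  ... | tri≈ _ u≡v _ = ⊥-elim (X-irreflexive Xuv (toℕ-injective u≡v))
  ... | tri> _ _ v<u = (v , u) , ∈-nonTreeEdges⁺ X T v<u (trans (X-sym v u) Xuv) (trans (T-sym v u) Tuv) ,
                       ≈ᵉ-trans (oriented-≈ (v , u)) (inj₂ (refl , refl))

  ze-at-own-arc : ∀ {e} → e ∈ E → ze e (tl e) (hd e) ≡ 1ℚ
  ze-at-own-arc e∈E = trans (ze-off-tree e∈E (T-oriented e∈E)) (edgeVec-self (tl≢hd e∈E))

  ze-at-other-arc : ∀ {e e′} → e ∈ E → e′ ∈ E → ¬ e′ ≡ e → ze e′ (tl e) (hd e) ≡ 0ℚ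
  ze-at-other-arc e∈E e′∈E e′≢e =
    trans (ze-off-tree e′∈E (T-oriented e∈E)) (edgeVec-≉ (e′≢e ∘ oriented-injective e∈E e′∈E))

  -- Coordinates: κB b and κE e take the value 1 on zb b and ze e respectively, and 0 on every other basis vector.
  κB : Fin n → ArcVec n → ℚ
  κB b f = - outflow f b

  pathPart : ArcVec n → ArcVec n
  pathPart f = combination B (λ b → κB b f) zb

  κE : Fin n × Fin n → ArcVec n → ℚ
  κE e f = f (tl e) (hd e) - pathPart f (tl e) (hd e)

  κB-linear : ∀ b → IsLinear (κB b)
  κB-linear b = neg-linear (outflow-linear b)

  κE-linear : ∀ e → IsLinear (κE e)
  κE-linear e = -linear (evaluation-linear (tl e) (hd e)) (Σˡ-linear B (λ b → zb b (tl e) (hd e)) κB-linear)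

  κB-zb : ∀ {b b′} → b ∈ B → b′ ∈ B → κB b (zb b′) ≡ δ (eqᵇ b′ b)
  κB-zb {b} {b′} b∈B b′∈B = begin
    - outflow (zb b′) b                 ≡⟨ cong -_ (zb-outflow b′∈B b) ⟩
    - (δ (eqᵇ a b) - δ (eqᵇ b′ b))      ≡⟨ cong (λ x → - (δ x - δ (eqᵇ b′ b))) (eqᵇ-≢ (proj₂ (∈-otherMarked⁻ S a b∈B) ∘ sym)) ⟩
    - (0ℚ - δ (eqᵇ b′ b))               ≡⟨ solve 1 (λ x → :- (con 0ℚ :- x) := x) refl (δ (eqᵇ b′ b)) ⟩
    δ (eqᵇ b′ b)                        ∎

  pathPart-ze : ∀ {e} → e ∈ E → ∀ u v → pathPart (ze e) u v ≡ 0ℚ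
  pathPart-ze {e} e∈E u v = Σˡ-zero B λ {b} _ → trans (cong (λ x → - x * zb b u v) (ze-outflow e∈E b)) (*-zeroˡ (zb b u v))

  pathPart-zb : ∀ {b} → b ∈ B → ∀ u v → pathPart (zb b) u v ≡ zb b u v
  pathPart-zb {b} b∈B u v = trans (Σˡ-concentrated B (otherMarked-unique S a) b∈B other-paths) own-path
    where
    other-paths : ∀ {b′} → b′ ∈ B → ¬ b′ ≡ b → κB b′ (zb b) * zb b′ u v ≡ 0ℚ
    other-paths {b′} b′∈B b′≢b =
      trans (cong (_* zb b′ u v) (trans (κB-zb b′∈B b∈B) (cong δ (eqᵇ-≢ (b′≢b ∘ sym))))) (*-zeroˡ (zb b′ u v))
    own-path : κB b (zb b) * zb b u v ≡ zb b u v
    own-path = trans (cong (_* zb b u v) (trans (κB-zb b∈B b∈B) (cong δ (eqᵇ-refl b)))) (*-identityˡ (zb b u v))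

  κE-ze : ∀ {e e′} → e ∈ E → e′ ∈ E → κE e (ze e′) ≡ ze e′ (tl e) (hd e)
  κE-ze {e} {e′} e∈E e′∈E = trans (cong (λ y → ze e′ (tl e) (hd e) - y) (pathPart-ze e′∈E (tl e) (hd e))) (+-identityʳ _)

  κE-zb : ∀ {e b} → b ∈ B → κE e (zb b) ≡ 0ℚ
  κE-zb {e} {b} b∈B = trans (cong (λ y → zb b (tl e) (hd e) - y) (pathPart-zb b∈B (tl e) (hd e))) (+-inverseʳ (zb b (tl e) (hd e)))

  paths-independent : ∀ bs → Unique bs → (∀ {b} → b ∈ bs → b ∈ B) → LinIndep (map zb bs)
  paths-independent []       _                  _    = λ _ _ ()
  paths-independent (b ∷ bs) (b∉bs ∷ unique) bs⊆B =
    linIndep-∷ (κB-linear b) κB-own≢0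
      (All.map⁺ (All.tabulate λ {b′} b′∈bs →
        trans (κB-zb b∈B (bs⊆B (there b′∈bs))) (cong δ (eqᵇ-≢ (All.lookup b∉bs b′∈bs ∘ sym)))))
      (paths-independent bs unique (bs⊆B ∘ there))
    where
    b∈B = bs⊆B (here refl)
    κB-own≢0 : ¬ κB b (zb b) ≡ 0ℚ
    κB-own≢0 eq = 1≢0 (trans (sym (trans (κB-zb b∈B b∈B) (cong δ (eqᵇ-refl b)))) eq)

  basis-independent : ∀ es → Unique es → (∀ {e} → e ∈ es → e ∈ E) → LinIndep (map ze es ++ map zb B)
  basis-independent []       _               _    = paths-independent B (otherMarked-unique S a) (λ b∈B → b∈B)
  basis-independent (e ∷ es) (e∉es ∷ unique) es⊆E =
    linIndep-∷ (κE-linear e) κE-own≢0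
      (All.++⁺ (All.map⁺ (All.tabulate λ {e′} e′∈es →
                  trans (κE-ze e∈E (es⊆E (there e′∈es))) (ze-at-other-arc e∈E (es⊆E (there e′∈es)) (All.lookup e∉es e′∈es ∘ sym))))
               (All.map⁺ (All.tabulate κE-zb)))
      (basis-independent es unique (es⊆E ∘ there))
    where
    e∈E = es⊆E (here refl)
    κE-own≢0 : ¬ κE e (ze e) ≡ 0ℚ
    κE-own≢0 eq = 1≢0 (trans (sym (trans (κE-ze e∈E e∈E) (ze-at-own-arc e∈E))) eq)

  module _ {f} (eig : InEigen1 f) where
    private
      module f = IsFlow (inEigen1⇒flow X k S simple regular connected Sa eig)

    cyclePart : ArcVec n
    cyclePart = combination E (λ e → κE e f) ze

    residual : ArcVec n
    residual u v = f u v - pathPart f u v - cyclePart u v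

    residual-antisymmetric : Antisymmetric residual
    residual-antisymmetric u v = begin
      f u v - pathPart f u v - cyclePart u v
        ≡⟨ cong₂ _-_ (cong₂ _-_ (f.antisymmetric u v) (combination-antisymmetric B (λ b → κB b f) zb (antisymmetric ∘ zb-flow) u v))
                     (combination-antisymmetric E (λ e → κE e f) ze (antisymmetric ∘ ze-flow) u v) ⟩
      - f v u - - pathPart f v u - - cyclePart v u
        ≡⟨ solve 3 (λ x y z → :- x :- :- y :- :- z := :- (x :- y :- z)) refl (f v u) (pathPart f v u) (cyclePart v u) ⟩
      - (f v u - pathPart f v u - cyclePart v u)
        ∎
      where open IsFlow

    residual-at-oriented : ∀ {e} → e ∈ E → residual (tl e) (hd e) ≡ 0ℚ
    residual-at-oriented {e} e∈E = begin
      κE e f - cyclePart (tl e) (hd e)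
        ≡⟨ cong (λ c → κE e f - c) (trans (Σˡ-concentrated E (nonTreeEdges-unique X T) e∈E other-cycles) own-cycle) ⟩
      κE e f - κE e f
        ≡⟨ +-inverseʳ (κE e f) ⟩
      0ℚ
        ∎
      where
      other-cycles : ∀ {e′} → e′ ∈ E → ¬ e′ ≡ e → κE e′ f * ze e′ (tl e) (hd e) ≡ 0ℚ
      other-cycles {e′} e′∈E e′≢e = trans (cong (κE e′ f *_) (ze-at-other-arc e∈E e′∈E e′≢e)) (*-zeroʳ (κE e′ f))
      own-cycle : κE e f * ze e (tl e) (hd e) ≡ κE e f
      own-cycle = trans (cong (κE e f *_) (ze-at-own-arc e∈E)) (*-identityʳ (κE e f))

    residual-supported : SupportedOn T residual
    residual-supported u v Tuv with X u v in Xuv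
    ... | false = cong₂ _-_ (cong₂ _-_ (f.supported u v Xuv) (combination-supported B (λ b → κB b f) zb (supported ∘ zb-flow) u v Xuv))
                            (combination-supported E (λ e → κE e f) ze (supported ∘ ze-flow) u v Xuv)
      where open IsFlow
    ... | true with e , e∈E , arcs≈ ← nontree-arc Xuv Tuv =
      ≈ᵉ-antisymmetric residual-antisymmetric arcs≈ (residual-at-oriented e∈E)

    outflow-pathPart : ∀ w → outflow (pathPart f) w ≡ Σˡ B (λ b → κB b f * (δ (eqᵇ a w) - δ (eqᵇ b w)))
    outflow-pathPart w = trans (combination-linear (outflow-linear w) B (λ b → κB b f) zb)
                               (Σˡ-cong B λ {b} b∈B → cong (κB b f *_) (zb-outflow b∈B w))

    outflow-cyclePart : ∀ w → outflow cyclePart w ≡ 0ℚ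
    outflow-cyclePart w = trans (combination-linear (outflow-linear w) E (λ e → κE e f) ze)
                                (Σˡ-zero E λ {e} e∈E → trans (cong (κE e f *_) (ze-outflow e∈E w)) (*-zeroʳ (κE e f)))

    outflow-pathPart-off-a : ∀ {w} → ¬ w ≡ a → outflow (pathPart f) w ≡ outflow f w
    outflow-pathPart-off-a {w} w≢a with S w in Sw
    ... | true  = trans (outflow-pathPart w) (trans (Σˡ-concentrated B (otherMarked-unique S a) (∈-otherMarked⁺ S a Sw w≢a) other) own)
      where
      a≢w = eqᵇ-≢ (w≢a ∘ sym)
      other : ∀ {b} → b ∈ B → ¬ b ≡ w → κB b f * (δ (eqᵇ a w) - δ (eqᵇ b w)) ≡ 0ℚ
      other {b} _ b≢w = trans (cong₂ (λ p q → κB b f * (δ p - δ q)) a≢w (eqᵇ-≢ b≢w)) (*-zeroʳ (κB b f))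
      own : κB w f * (δ (eqᵇ a w) - δ (eqᵇ w w)) ≡ outflow f w
      own = trans (cong₂ (λ p q → κB w f * (δ p - δ q)) a≢w (eqᵇ-refl w))
                  (solve 1 (λ x → (:- x) :* (con 0ℚ :- con 1ℚ) := x) refl (outflow f w))
    ... | false = trans (outflow-pathPart w) (trans (Σˡ-zero B unmarked) (sym (f.conserved w Sw)))
      where
      unmarked : ∀ {b} → b ∈ B → κB b f * (δ (eqᵇ a w) - δ (eqᵇ b w)) ≡ 0ℚ
      unmarked {b} b∈B = trans (cong₂ (λ p q → κB b f * (δ p - δ q)) (eqᵇ-≢ (w≢a ∘ sym))
                                      (eqᵇ-≢ λ { refl → case trans (sym (proj₁ (∈-otherMarked⁻ S a b∈B))) Sw of λ () }))
                               (*-zeroʳ (κB b f))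

    residual-outflow : ∀ w → outflow residual w ≡ 0ℚ
    residual-outflow = conserved-at-remaining-vertex residual-antisymmetric a λ w w≢a → begin
      outflow residual w
        ≡⟨ trans (Σᶠ-distrib-- (λ v → f w v - pathPart f w v) (cyclePart w))
                 (cong (_- outflow cyclePart w) (Σᶠ-distrib-- (f w) (pathPart f w))) ⟩
      outflow f w - outflow (pathPart f) w - outflow cyclePart w
        ≡⟨ cong₂ (λ p c → outflow f w - p - c) (outflow-pathPart-off-a w≢a) (outflow-cyclePart w) ⟩
      outflow f w - outflow f w - 0ℚ
        ≡⟨ trans (+-identityʳ _) (+-inverseʳ (outflow f w)) ⟩
      0ℚ
        ∎

    residual≡0 : ∀ u v → residual u v ≡ 0ℚ
    residual≡0 = circulation-≡0 T-simple (proj₂ (proj₂ (proj₂ spanning)))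
      record { supported = residual-supported ; antisymmetric = residual-antisymmetric ; conserved = λ w _ → residual-outflow w }

    spanned : ∃ λ cs → ∀ u v → lincomb (map ze E ++ map zb B) cs u v ≡ f u v
    spanned with cs , cs-combination ← lincomb-map-++ ze zb E B (λ e → κE e f) (λ b → κB b f) = cs , λ u v → begin
      lincomb (map ze E ++ map zb B) cs u v
        ≡⟨ cs-combination u v ⟩
      cyclePart u v + pathPart f u v
        ≡⟨ solve 3 (λ x y z → z :+ y := x :- (x :- y :- z)) refl (f u v) (pathPart f u v) (cyclePart u v) ⟩
      f u v - residual u v
        ≡⟨ cong (λ r → f u v - r) (residual≡0 u v) ⟩
      f u v - 0ℚ
        ≡⟨ +-identityʳ (f u v) ⟩
      f u v
        ∎

  basis : IsBasisOf InEigen1 (map ze E ++ map zb B)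
  basis = All.++⁺ (All.map⁺ (All.tabulate (flow⇒inEigen1 X k S simple ∘ ze-flow)))
                  (All.map⁺ (All.tabulate (flow⇒inEigen1 X k S simple ∘ zb-flow))) ,
          basis-independent E (nonTreeEdges-unique X T) (λ e∈E → e∈E) ,
          λ f → spanned

theorem3p3 :
    (n k : ℕ) (X : Graph n) → IsSimple X → IsRegular X k → IsConnected X →
    (S : Fin n → Bool) (T : Graph n) → IsSpanningTree X T →
    (a : Fin n) → S a ≡ true →
    (orient : Fin n × Fin n → Bool) (cyc : Fin n × Fin n → List (Fin n)) →
    (∀ e → e ∈ nonTreeEdges X T →
      IsPath T (headOf (oriented (orient e) e)) (tailOf (oriented (orient e) e)) (cyc e)) →
    (pth : Fin n → List (Fin n)) →
    (∀ b → b ∈ otherMarked S a → IsPath X a b (pth b)) →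
    IsBasisOf (Walk-matrices.InEigen1 X k S)
      (map (λ e → walkVec (tailOf (oriented (orient e) e) ∷ cyc e)) (nonTreeEdges X T)
        ++ map (λ b → walkVec (pth b)) (otherMarked S a))
theorem3p3 n k X simple regular connected S T spanning a Sa orient cyc cyc-path pth pth-path =
  FundamentalBasis.basis simple regular connected spanning Sa orient cyc cyc-path pth pth-path
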